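{- Let $D$ be the distance matrix of a finite tree $G=(V,E)$ with positive edge lengths $\{\alpha_e\}$, and let $S\subseteq V$ be nonempty. Then \[ \frac{\det D[S]}{\operatorname{cof} D[S]} = \max\{\mathbf{u}^\intercal D\,\mathbf{u} : \mathbf{u}\in\mathbb{R}^V,\ \mathbf{1}^\intercal\mathbf{u}=1,\ \mathbf{u}_v=0 \text{ for all } v\notin S\}. \]
   Context: $D$ has $(u,v)$-entry the sum of $\alpha_e$ along the unique path from $u$ to $v$; $D[S]$ is the principal submatrix indexed by $S$. For a $k\times k$ matrix $M$, $\operatorname{cof}M=\sum_{i,j}(-1)^{i+j}\det M_{i,j}$, with $M_{i,j}$ obtained by deleting row $i$ and column $j$ (for $k=1$, $\operatorname{cof}M=1$). $\mathbf{1}$ is the all-ones vector. -}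

module Defs where

open import Level using (Level; _⊔_) renaming (suc to lsuc)
open import Algebra.Bundles using (CommutativeRing)
open import Relation.Binary.Core using (Rel)
open import Relation.Binary.Structures using (IsTotalOrder)
open import Relation.Nullary using (¬_)
open import Relation.Binary.PropositionalEquality using (_≡_; _≢_)
open import Data.Nat using (ℕ; zero; suc) renaming (_+_ to _+ℕ_)
open import Data.Fin using (Fin; zero; suc; toℕ; punchIn)
open import Data.Product using (Σ; ∃; _×_; _,_; proj₁; proj₂)
open import Data.Sum using (_⊎_)
open import Data.List using (List; []; _∷_)
open import Data.List.Relation.Unary.Unique.Propositional using (Unique)
open import Function.Definitions using (Injective)

record OrderedField (c ℓ₁ ℓ₂ : Level) : Set (lsuc (c ⊔ ℓ₁ ⊔ ℓ₂)) where
  field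
    commutativeRing : CommutativeRing c ℓ₁
  open CommutativeRing commutativeRing public
  field
    _≤_          : Rel Carrier ℓ₂
    isTotalOrder : IsTotalOrder _≈_ _≤_
    +-mono-≤     : ∀ {a b} x → a ≤ b → (a + x) ≤ (b + x)
    *-nonneg     : ∀ {a b} → 0# ≤ a → 0# ≤ b → 0# ≤ (a * b)
    0≉1          : ¬ (0# ≈ 1#)
    inverse      : ∀ a → ¬ (a ≈ 0#) → ∃ λ b → (a * b) ≈ 1#

  _<_ : Rel Carrier (ℓ₁ ⊔ ℓ₂)
  a < b = (a ≤ b) × ¬ (a ≈ b)

module MatrixDefs {c ℓ : Level} (R : CommutativeRing c ℓ) where
  open CommutativeRing R hiding (zero)

  sumF : ∀ {k} → (Fin k → Carrier) → Carrier
  sumF {zero}  f = 0#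
  sumF {suc k} f = f zero + sumF (λ i → f (suc i))

  sign : ℕ → Carrier
  sign zero    = 1#
  sign (suc n) = - sign n

  minor : ∀ {k} → Fin (suc k) → Fin (suc k) →
          (Fin (suc k) → Fin (suc k) → Carrier) → Fin k → Fin k → Carrier
  minor i j M a b = M (punchIn i a) (punchIn j b)

  det : ∀ k → (Fin k → Fin k → Carrier) → Carrier
  det zero    M = 1#
  det (suc k) M = sumF (λ j → (sign (toℕ j) * M zero j) * det k (minor zero j M))

  -- cof M = Σ_{i,j} (-1)^{i+j} det M_{i,j}  (equals 1 for 1×1 matrices)
  cof : ∀ k → (Fin (suc k) → Fin (suc k) → Carrier) → Carrier
  cof k M = sumF (λ i → sumF (λ j → sign (toℕ i +ℕ toℕ j) * det k (minor i j M)))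

  quadForm : ∀ {n} → (Fin n → Fin n → Carrier) → (Fin n → Carrier) → Carrier
  quadForm M u = sumF (λ i → sumF (λ j → (u i * M i j) * u j))

record Graph (n m : ℕ) : Set where
  field
    ends : Fin m → Fin n × Fin n

module GraphDefs {n m : ℕ} (G : Graph n m) where
  open Graph G

  Joins : Fin m → Fin n → Fin n → Set
  Joins e u w = (ends e ≡ (u , w)) ⊎ (ends e ≡ (w , u))

  data Walk : Fin n → Fin n → Set where
    []   : ∀ {u} → Walk u u
    step : ∀ {u w v} (e : Fin m) → Joins e u w → Walk w v → Walk u v

  vertices : ∀ {u v} → Walk u v → List (Fin n)
  vertices {u} []             = u ∷ []
  vertices {u} (step e _ p)   = u ∷ vertices p

  edges : ∀ {u v} → Walk u v → List (Fin m)
  edges []           = []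
  edges (step e _ p) = e ∷ edges p

  Path : Fin n → Fin n → Set
  Path u v = Σ (Walk u v) (λ p → Unique (vertices p))

  IsTree : Set
  IsTree = (∀ e → proj₁ (ends e) ≢ proj₂ (ends e))
         × (∀ u v → Path u v)
         × (∀ u v (p q : Path u v) → edges (proj₁ p) ≡ edges (proj₁ q))

  module _ {c ℓ} (R : CommutativeRing c ℓ) where
    open CommutativeRing R hiding (zero)

    length : (Fin m → Carrier) → ∀ {u v} → Walk u v → Carrier
    length α []           = 0#
    length α (step e _ p) = α e + length α p

    IsDistanceMatrix : (Fin m → Carrier) → (Fin n → Fin n → Carrier) → Set ℓ
    IsDistanceMatrix α D = ∀ u v (p : Path u v) → D u v ≈ length α (proj₁ p)

{-# OPTIONS --safe #-}

-- Root the tree at ρ.  Then D u v = Σₑ αₑ [e lies on exactly one of the paths u → ρ, v → ρ], so for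
-- Σ x = 0 the linear terms cancel and xᵀ D x = -2 Σₑ αₑ yₑ², where yₑ is the total of x over the
-- vertices below e.  Hence D, and with it every principal submatrix A = D[S], is conditionally
-- negative definite: xᵀ A x ≤ 0 on Σ x = 0, with equality only at x = 0 (downward induction on depth).
-- For such a symmetric A, solving the (nonsingular) system on the hyperplane Σ x = 0 gives u with
-- Σ u = 1 and A u = r 𝟏; writing x = (Σ x) u + y with Σ y = 0 shows xᵀ A x = (Σ x)² r + yᵀ A y,
-- so r is the maximum.  Since u is a null vector of A - r J, the matrix determinant lemma
-- det (A + t J) = det A + t cof A gives det A = r cof A; and cof A ≠ 0 because A - (r + 1) J is
-- anisotropic, hence nonsingular.

module Submission where

open import Defs
open import Level using (Level; _⊔_)
open import Algebra.Bundles using (CommutativeRing)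
open import Algebra.Solver.Ring.AlmostCommutativeRing using (fromCommutativeRing; _-Raw-AlmostCommutative⟶_)
import Algebra.Solver.Ring
import Algebra.Properties.Ring
import Algebra.Properties.Group
import Algebra.Properties.Semiring.Mult.TCOptimised
import Algebra.Properties.Semiring.Sum
import Algebra.Properties.CommutativeMonoid.Sum
open import Data.Nat as ℕ using (ℕ; zero; suc)
import Data.Nat.Properties as ℕₚ
open import Data.Nat.Induction using (<-wellFounded)
open import Data.Integer as ℤ using (ℤ; +_; -[1+_]; _⊖_; _◃_; ∣_∣)
open import Data.Integer.Properties using ([1+m]⊖[1+n]≡m⊖n; ◃-inverse) renaming (_≟_ to _≟ℤ_)
open import Data.Sign as Sign using (Sign)
open import Data.Fin using (Fin; zero; suc; toℕ; punchIn; inject₁)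
open import Data.Fin.Properties using (punchInᵢ≢i; suc-injective; toℕ-inject₁; any?) renaming (_≟_ to _≟F_)
open import Data.Fin.Induction using (<-weakInduction)
open import Data.Vec.Functional using (updateAt)
open import Data.Vec.Functional.Properties using (updateAt-updates; updateAt-minimal)
open import Data.Bool using (Bool; true; false; _xor_)
open import Data.Bool.Properties using (xor-assoc; xor-comm; xor-same; xor-identityʳ)
open import Data.Maybe using (Maybe; just; nothing)
open import Data.Empty using (⊥; ⊥-elim)
open import Data.Product using (Σ; _×_; _,_; proj₁; proj₂)
open import Data.Sum using (_⊎_; inj₁; inj₂)
open import Data.List as List using (List; []; _∷_; _++_)
open import Data.List.Properties using (length-++)
open import Data.List.Relation.Unary.Any using (here; there)
open import Data.List.Relation.Unary.All as All using ()
open import Data.List.Relation.Unary.AllPairs as AllPairs using ()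
open import Data.List.Relation.Unary.Unique.Propositional using (Unique)
open import Data.List.Membership.Propositional using (_∈_)
import Data.List.Membership.DecPropositional as DecMembership
open import Function using (_∘_; _$_)
open import Function.Definitions using (Injective)
open import Induction.WellFounded as WF using ()
open import Relation.Binary.Construct.On as On using ()
open import Relation.Binary.Structures using (IsTotalOrder)
open import Relation.Nullary using (¬_; yes; no; does)
open import Relation.Binary.PropositionalEquality as ≡ using (_≡_; _≢_)

-- The ring solver needs coefficients with a (semi-)decision procedure for equality; the carrier
-- has none, so integer coefficients are interpreted through the canonical map ℤ → R.
module IntegerCoefficientSolver {c ℓ} (R : CommutativeRing c ℓ) where
  open CommutativeRing R hiding (zero)
  open Algebra.Properties.Ring ring using (-‿involutive; -‿distribˡ-*; -0#≈0#; -‿+-comm)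
  open Algebra.Properties.Semiring.Mult.TCOptimised semiring using (1+×; ×-homo-+; ×1-homo-*) renaming (_×_ to _×ᴿ_)
  open import Relation.Binary.Reasoning.Setoid setoid

  fromℤ : ℤ → Carrier
  fromℤ (+ n)    = n ×ᴿ 1#
  fromℤ -[1+ n ] = - (suc n ×ᴿ 1#)

  fromSign : Sign → Carrier
  fromSign Sign.+ = 1#
  fromSign Sign.- = - 1#

  private
    cancel-+ˡ-- : ∀ a x y → (a + x) - (a + y) ≈ x - y
    cancel-+ˡ-- a x y = begin
      (a + x) - (a + y)      ≈⟨ +-congˡ (-‿cong (+-comm a y)) ⟩
      (a + x) - (y + a)      ≈⟨ +-congˡ (sym (-‿+-comm y a)) ⟩
      (a + x) + (- y - a)    ≈⟨ +-congʳ (+-comm a x) ⟩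
      (x + a) + (- y - a)    ≈⟨ +-assoc x a _ ⟩
      x + (a + (- y - a))    ≈⟨ +-congˡ (+-congˡ (+-comm (- y) (- a))) ⟩
      x + (a + (- a - y))    ≈⟨ +-congˡ (sym (+-assoc a (- a) (- y))) ⟩
      x + ((a - a) - y)      ≈⟨ +-congˡ (+-congʳ (-‿inverseʳ a)) ⟩
      x + (0# - y)           ≈⟨ +-congˡ (+-identityˡ (- y)) ⟩
      x - y                  ∎

  fromℤ-⊖ : ∀ m n → fromℤ (m ⊖ n) ≈ m ×ᴿ 1# - n ×ᴿ 1#
  fromℤ-⊖ m       zero    = sym (trans (+-congˡ -0#≈0#) (+-identityʳ _))
  fromℤ-⊖ zero    (suc n) = sym (+-identityˡ _)
  fromℤ-⊖ (suc m) (suc n) = begin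
    fromℤ (suc m ⊖ suc n)          ≡⟨ ≡.cong fromℤ ([1+m]⊖[1+n]≡m⊖n m n) ⟩
    fromℤ (m ⊖ n)                  ≈⟨ fromℤ-⊖ m n ⟩
    m ×ᴿ 1# - n ×ᴿ 1#                ≈⟨ cancel-+ˡ-- 1# _ _ ⟨
    (1# + m ×ᴿ 1#) - (1# + n ×ᴿ 1#)  ≈⟨ +-cong (1+× m 1#) (-‿cong (1+× n 1#)) ⟨
    suc m ×ᴿ 1# - suc n ×ᴿ 1#        ∎

  fromℤ-+ : ∀ i j → fromℤ (i ℤ.+ j) ≈ fromℤ i + fromℤ j
  fromℤ-+ (+ m)    (+ n)    = ×-homo-+ 1# m n
  fromℤ-+ (+ m)    -[1+ n ] = fromℤ-⊖ m (suc n)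
  fromℤ-+ -[1+ m ] (+ n)    = trans (fromℤ-⊖ n (suc m)) (+-comm _ _)
  fromℤ-+ -[1+ m ] -[1+ n ] = begin
    - (suc (suc (m ℕ.+ n)) ×ᴿ 1#)        ≡⟨ ≡.cong (λ k → - (k ×ᴿ 1#)) (≡.cong suc (ℕₚ.+-suc m n)) ⟨
    - ((suc m ℕ.+ suc n) ×ᴿ 1#)          ≈⟨ -‿cong (×-homo-+ 1# (suc m) (suc n)) ⟩
    - (suc m ×ᴿ 1# + suc n ×ᴿ 1#)         ≈⟨ -‿+-comm _ _ ⟨
    - (suc m ×ᴿ 1#) - (suc n ×ᴿ 1#)       ∎

  fromℤ-neg : ∀ i → fromℤ (ℤ.- i) ≈ - fromℤ i
  fromℤ-neg (+ zero)  = sym -0#≈0#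
  fromℤ-neg (+ suc n) = refl
  fromℤ-neg -[1+ n ]  = sym (-‿involutive _)

  fromℤ-◃ : ∀ s n → fromℤ (s ◃ n) ≈ fromSign s * (n ×ᴿ 1#)
  fromℤ-◃ s      zero    = sym (zeroʳ _)
  fromℤ-◃ Sign.+ (suc n) = sym (*-identityˡ _)
  fromℤ-◃ Sign.- (suc n) = trans (-‿cong (sym (*-identityˡ _))) (-‿distribˡ-* _ _)

  fromSign-* : ∀ s t → fromSign (s Sign.* t) ≈ fromSign s * fromSign t
  fromSign-* Sign.+ t      = sym (*-identityˡ _)
  fromSign-* Sign.- Sign.+ = sym (*-identityʳ _)
  fromSign-* Sign.- Sign.- = begin
    1#               ≈⟨ -‿involutive 1# ⟨
    - - 1#           ≈⟨ -‿cong (*-identityˡ (- 1#)) ⟨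
    - (1# * - 1#)    ≈⟨ -‿distribˡ-* 1# (- 1#) ⟩
    - 1# * - 1#      ∎

  fromℤ-* : ∀ i j → fromℤ (i ℤ.* j) ≈ fromℤ i * fromℤ j
  fromℤ-* i j = begin
    fromℤ (ℤ.sign i Sign.* ℤ.sign j ◃ ∣ i ∣ ℕ.* ∣ j ∣)
      ≈⟨ fromℤ-◃ (ℤ.sign i Sign.* ℤ.sign j) (∣ i ∣ ℕ.* ∣ j ∣) ⟩
    fromSign (ℤ.sign i Sign.* ℤ.sign j) * ((∣ i ∣ ℕ.* ∣ j ∣) ×ᴿ 1#)
      ≈⟨ *-cong (fromSign-* (ℤ.sign i) (ℤ.sign j)) (×1-homo-* ∣ i ∣ ∣ j ∣) ⟩
    (fromSign (ℤ.sign i) * fromSign (ℤ.sign j)) * (∣ i ∣ ×ᴿ 1# * ∣ j ∣ ×ᴿ 1#)  ≈⟨ interchange _ _ _ _ ⟩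
    (fromSign (ℤ.sign i) * ∣ i ∣ ×ᴿ 1#) * (fromSign (ℤ.sign j) * ∣ j ∣ ×ᴿ 1#)  ≈⟨ *-cong (split i) (split j) ⟨
    fromℤ i * fromℤ j                                               ∎
    where
    split : ∀ i → fromℤ i ≈ fromSign (ℤ.sign i) * (∣ i ∣ ×ᴿ 1#)
    split i = trans (reflexive (≡.cong fromℤ (≡.sym (◃-inverse i)))) (fromℤ-◃ (ℤ.sign i) ∣ i ∣)
    interchange : ∀ a b x y → (a * b) * (x * y) ≈ (a * x) * (b * y)
    interchange a b x y = begin
      (a * b) * (x * y)  ≈⟨ *-assoc a b _ ⟩
      a * (b * (x * y))  ≈⟨ *-congˡ (*-assoc b x y) ⟨
      a * ((b * x) * y)  ≈⟨ *-congˡ (*-congʳ (*-comm b x)) ⟩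
      a * ((x * b) * y)  ≈⟨ *-congˡ (*-assoc x b y) ⟩
      a * (x * (b * y))  ≈⟨ *-assoc a x _ ⟨
      (a * x) * (b * y)  ∎

  fromℤ-morphism : ℤ.+-*-rawRing -Raw-AlmostCommutative⟶ fromCommutativeRing R
  fromℤ-morphism = record
    { ⟦_⟧    = fromℤ
    ; +-homo = fromℤ-+
    ; *-homo = fromℤ-*
    ; -‿homo = fromℤ-neg
    ; 0-homo = refl
    ; 1-homo = refl
    }

  fromℤ-≟ : ∀ i j → Maybe (fromℤ i ≈ fromℤ j)
  fromℤ-≟ i j with i ≟ℤ j
  ... | yes ≡.refl = just refl
  ... | no _       = nothing

  open Algebra.Solver.Ring ℤ.+-*-rawRing (fromCommutativeRing R) fromℤ-morphism fromℤ-≟ public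

module FiniteSums {c ℓ} (R : CommutativeRing c ℓ) where
  open CommutativeRing R hiding (zero)
  open MatrixDefs R using (sumF)
  open Algebra.Properties.Ring ring using (-0#≈0#; -‿+-comm)
  open Algebra.Properties.CommutativeMonoid.Sum +-commutativeMonoid
    using (sum; ∑-distrib-+; ∑-comm; sum-remove)
  open Algebra.Properties.Semiring.Sum semiring using (*-distribˡ-sum; *-distribʳ-sum)
  open import Relation.Binary.Reasoning.Setoid setoid

  private
    variable
      k l : ℕ

    sumF≈sum : (f : Fin k → Carrier) → sumF f ≈ sum f
    sumF≈sum {zero}  f = refl
    sumF≈sum {suc k} f = +-congˡ (sumF≈sum (f ∘ suc))

  sumF-cong : {f g : Fin k → Carrier} → (∀ i → f i ≈ g i) → sumF f ≈ sumF g
  sumF-cong {zero}  eq = refl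
  sumF-cong {suc k} eq = +-cong (eq zero) (sumF-cong (eq ∘ suc))

  sumF-zero : (f : Fin k → Carrier) → (∀ i → f i ≈ 0#) → sumF f ≈ 0#
  sumF-zero {zero}  f eq = refl
  sumF-zero {suc k} f eq = trans (+-cong (eq zero) (sumF-zero (f ∘ suc) (eq ∘ suc))) (+-identityˡ 0#)

  sumF-distrib-+ : (f g : Fin k → Carrier) → sumF (λ i → f i + g i) ≈ sumF f + sumF g
  sumF-distrib-+ f g = begin
    sumF (λ i → f i + g i)  ≈⟨ sumF≈sum (λ i → f i + g i) ⟩
    sum (λ i → f i + g i)   ≈⟨ ∑-distrib-+ f g ⟩
    sum f + sum g           ≈⟨ +-cong (sumF≈sum f) (sumF≈sum g) ⟨
    sumF f + sumF g         ∎

  sumF-neg : (f : Fin k → Carrier) → sumF (λ i → - f i) ≈ - sumF f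
  sumF-neg {zero}  f = sym -0#≈0#
  sumF-neg {suc k} f = trans (+-congˡ (sumF-neg (f ∘ suc))) (-‿+-comm _ _)

  *-distribˡ-sumF : ∀ x (f : Fin k → Carrier) → x * sumF f ≈ sumF (λ i → x * f i)
  *-distribˡ-sumF x f = begin
    x * sumF f               ≈⟨ *-congˡ (sumF≈sum f) ⟩
    x * sum f                ≈⟨ *-distribˡ-sum x f ⟩
    sum (λ i → x * f i)      ≈⟨ sumF≈sum (λ i → x * f i) ⟨
    sumF (λ i → x * f i)     ∎

  *-distribʳ-sumF : ∀ x (f : Fin k → Carrier) → sumF f * x ≈ sumF (λ i → f i * x)
  *-distribʳ-sumF x f = begin
    sumF f * x               ≈⟨ *-congʳ (sumF≈sum f) ⟩
    sum f * x                ≈⟨ *-distribʳ-sum x f ⟩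
    sum (λ i → f i * x)      ≈⟨ sumF≈sum (λ i → f i * x) ⟨
    sumF (λ i → f i * x)     ∎

  sumF-linear : ∀ a b (f g : Fin k → Carrier) →
                sumF (λ j → a * f j + b * g j) ≈ a * sumF f + b * sumF g
  sumF-linear a b f g = trans (sumF-distrib-+ (λ j → a * f j) (λ j → b * g j))
                              (sym (+-cong (*-distribˡ-sumF a f) (*-distribˡ-sumF b g)))

  sumF-comm : (f : Fin k → Fin l → Carrier) →
              sumF (λ i → sumF (f i)) ≈ sumF (λ j → sumF (λ i → f i j))
  sumF-comm f = begin
    sumF (λ i → sumF (f i))            ≈⟨ sumF-cong (λ i → sumF≈sum (f i)) ⟩
    sumF (λ i → sum (f i))             ≈⟨ sumF≈sum (λ i → sum (f i)) ⟩
    sum (λ i → sum (f i))              ≈⟨ ∑-comm f ⟩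
    sum (λ j → sum (λ i → f i j))      ≈⟨ sumF≈sum (λ j → sum (λ i → f i j)) ⟨
    sumF (λ j → sum (λ i → f i j))     ≈⟨ sumF-cong (λ j → sumF≈sum (λ i → f i j)) ⟨
    sumF (λ j → sumF (λ i → f i j))    ∎

  sumF-remove : (f : Fin (suc k) → Carrier) (i : Fin (suc k)) →
                sumF f ≈ f i + sumF (f ∘ punchIn i)
  sumF-remove f i = begin
    sumF f                   ≈⟨ sumF≈sum f ⟩
    sum f                    ≈⟨ sum-remove f ⟩
    f i + sum (f ∘ punchIn i)  ≈⟨ +-congˡ (sumF≈sum (f ∘ punchIn i)) ⟨
    f i + sumF (f ∘ punchIn i) ∎

  sumF-δ : (f : Fin k → Carrier) (i : Fin k) → (∀ j → j ≢ i → f j ≈ 0#) → sumF f ≈ f i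
  sumF-δ {suc k} f i off = begin
    sumF f                      ≈⟨ sumF-remove f i ⟩
    f i + sumF (f ∘ punchIn i)  ≈⟨ +-congˡ (sumF-zero _ (λ j → off (punchIn i j) (punchInᵢ≢i i j))) ⟩
    f i + 0#                    ≈⟨ +-identityʳ (f i) ⟩
    f i                         ∎

  sumF-*-sumF : (f : Fin k → Carrier) (g : Fin l → Carrier) →
                sumF f * sumF g ≈ sumF (λ i → sumF (λ j → f i * g j))
  sumF-*-sumF f g = trans (*-distribʳ-sumF (sumF g) f) (sumF-cong (λ i → *-distribˡ-sumF (f i) g))

module Matrices {c ℓ} (R : CommutativeRing c ℓ) where
  open CommutativeRing R hiding (zero)
  open MatrixDefs R using (sumF; quadForm)
  open FiniteSums R
  open IntegerCoefficientSolver R using (solve; _:=_; _:+_; _:*_)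
  open import Relation.Binary.Reasoning.Setoid setoid

  Matrix : ℕ → Set c
  Matrix k = Fin k → Fin k → Carrier

  private
    variable
      k : ℕ

  Symmetric : Matrix k → Set ℓ
  Symmetric A = ∀ i j → A i j ≈ A j i

  _*ᵥ_ : Matrix k → (Fin k → Carrier) → Fin k → Carrier
  (M *ᵥ x) i = sumF (λ j → M i j * x j)

  addConstant : Matrix k → Carrier → Matrix k
  addConstant A t a b = A a b + t

  bilinear : Matrix k → (x y : Fin k → Carrier) → Carrier
  bilinear A x y = sumF (λ i → sumF (λ j → (x i * A i j) * y j))

  bilinear≈dot-*ᵥ : ∀ (A : Matrix k) x y → bilinear A x y ≈ sumF (λ i → x i * (A *ᵥ y) i)
  bilinear≈dot-*ᵥ A x y = sumF-cong λ i →
    trans (sumF-cong (λ j → *-assoc (x i) (A i j) (y j))) (sym (*-distribˡ-sumF (x i) (λ j → A i j * y j)))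

  bilinear-sym : ∀ {A : Matrix k} → Symmetric A → ∀ x y → bilinear A x y ≈ bilinear A y x
  bilinear-sym {A = A} sym-A x y = trans (sumF-comm (λ i j → (x i * A i j) * y j)) (sumF-cong λ j → sumF-cong λ i →
    trans (*-congʳ (*-congˡ (sym-A i j))) (solve 3 (λ a m b → (a :* m) :* b := (b :* m) :* a) refl (x i) (A j i) (y j)))

  private
    sumF-combine : ∀ a b (f g h : Fin k → Carrier) →
      sumF (λ i → f i + (a * g i + b * h i)) ≈ sumF f + (a * sumF g + b * sumF h)
    sumF-combine a b f g h = trans (sumF-distrib-+ f _) (+-congˡ (trans
      (sumF-distrib-+ (λ i → a * g i) (λ i → b * h i))
      (sym (+-cong (*-distribˡ-sumF a g) (*-distribˡ-sumF b h)))))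

  quadForm-+-* : ∀ {A : Matrix k} → Symmetric A → ∀ y t u →
    quadForm A (λ i → y i + t * u i) ≈ quadForm A y + ((t + t) * bilinear A y u + (t * t) * quadForm A u)
  quadForm-+-* {A = A} sym-A y t u = begin
    quadForm A (λ i → y i + t * u i)
      ≈⟨ sumF-cong (λ i → sumF-cong λ j →
           solve 6 (λ yi ui yj uj a t → ((yi :+ t :* ui) :* a) :* (yj :+ t :* uj)
                     := (yi :* a) :* yj :+ (t :* ((yi :* a) :* uj :+ (ui :* a) :* yj) :+ (t :* t) :* ((ui :* a) :* uj)))
                   refl (y i) (u i) (y j) (u j) (A i j) t) ⟩
    sumF (λ i → sumF (λ j → P i j + (t * (Q i j + Q′ i j) + (t * t) * W i j)))
      ≈⟨ sumF-cong (λ i → sumF-combine t (t * t) (P i) (λ j → Q i j + Q′ i j) (W i)) ⟩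
    sumF (λ i → sumF (P i) + (t * sumF (λ j → Q i j + Q′ i j) + (t * t) * sumF (W i)))
      ≈⟨ sumF-combine t (t * t) (λ i → sumF (P i)) (λ i → sumF (λ j → Q i j + Q′ i j)) (λ i → sumF (W i)) ⟩
    quadForm A y + (t * sumF (λ i → sumF (λ j → Q i j + Q′ i j)) + (t * t) * quadForm A u)
      ≈⟨ +-congˡ (+-congʳ (*-congˡ (trans (sumF-cong (λ i → sumF-distrib-+ (Q i) (Q′ i)))
                                          (sumF-distrib-+ (λ i → sumF (Q i)) (λ i → sumF (Q′ i)))))) ⟩
    quadForm A y + (t * (bilinear A y u + bilinear A u y) + (t * t) * quadForm A u)
      ≈⟨ +-congˡ (+-congʳ (trans (*-congˡ (+-congˡ (bilinear-sym sym-A u y)))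
                                 (trans (distribˡ t _ _) (sym (distribʳ (bilinear A y u) t t))))) ⟩
    quadForm A y + ((t + t) * bilinear A y u + (t * t) * quadForm A u) ∎
    where
    P Q Q′ W : Fin _ → Fin _ → Carrier
    P  i j = (y i * A i j) * y j
    Q  i j = (y i * A i j) * u j
    Q′ i j = (u i * A i j) * y j
    W  i j = (u i * A i j) * u j

  quadForm-addConstant : ∀ (A : Matrix k) s x → quadForm (addConstant A s) x ≈ quadForm A x + s * (sumF x * sumF x)
  quadForm-addConstant A s x = begin
    quadForm (addConstant A s) x
      ≈⟨ sumF-cong (λ i → sumF-cong λ j →
           solve 4 (λ a m s b → (a :* (m :+ s)) :* b := (a :* m) :* b :+ s :* (a :* b)) refl (x i) (A i j) s (x j)) ⟩
    sumF (λ i → sumF (λ j → (x i * A i j) * x j + s * (x i * x j)))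
      ≈⟨ trans (sumF-cong (λ i → trans (sumF-distrib-+ (λ j → (x i * A i j) * x j) (λ j → s * (x i * x j)))
                                       (+-congˡ (sym (*-distribˡ-sumF s (λ j → x i * x j))))))
               (trans (sumF-distrib-+ (λ i → sumF (λ j → (x i * A i j) * x j)) (λ i → s * sumF (λ j → x i * x j)))
                      (+-congˡ (sym (*-distribˡ-sumF s (λ i → sumF (λ j → x i * x j)))))) ⟩
    quadForm A x + s * sumF (λ i → sumF (λ j → x i * x j))
      ≈⟨ +-congˡ (*-congˡ (sym (sumF-*-sumF x x))) ⟩
    quadForm A x + s * (sumF x * sumF x) ∎

NoTwoTorsion : ∀ {c ℓ} → CommutativeRing c ℓ → Set (c ⊔ ℓ)
NoTwoTorsion R = ∀ x → x + x ≈ 0# → x ≈ 0#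
  where
  open CommutativeRing R

module Determinants {c ℓ} (R : CommutativeRing c ℓ) (x+x≈0⇒x≈0 : NoTwoTorsion R) where
  open CommutativeRing R hiding (zero)
  open MatrixDefs R
  open FiniteSums R
  open Matrices R
  open IntegerCoefficientSolver R using (solve; _:=_; _:+_; _:*_; :-_; _:-_; con)
  open Algebra.Properties.Ring ring using (-‿involutive; -0#≈0#)
  open Algebra.Properties.Group +-group using (inverseʳ-unique)
  open import Relation.Binary.Reasoning.Setoid setoid

  private
    variable
      k : ℕ

  firstRowTerm : Matrix (suc k) → Fin (suc k) → Carrier
  firstRowTerm {k} M j = (sign (toℕ j) * M zero j) * det k (minor zero j M)

  AgreeOffRow : Fin k → Matrix k → Matrix k → Set ℓ
  AgreeOffRow i M N = ∀ r → r ≢ i → ∀ c → M r c ≈ N r c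

  det-cong : ∀ k {M N : Matrix k} → (∀ a b → M a b ≈ N a b) → det k M ≈ det k N
  det-cong zero    eq = refl
  det-cong (suc k) eq = sumF-cong λ j →
    *-cong (*-congˡ {sign (toℕ j)} (eq zero j)) (det-cong k (λ a b → eq (suc a) (punchIn j b)))

  private
    det-linear-termwise : ∀ a b {M N P : Matrix (suc k)} →
      (∀ j → firstRowTerm P j ≈ a * firstRowTerm M j + b * firstRowTerm N j) →
      det (suc k) P ≈ a * det (suc k) M + b * det (suc k) N
    det-linear-termwise a b {M} {N} terms =
      trans (sumF-cong terms) (sumF-linear a b (firstRowTerm M) (firstRowTerm N))

  det-linear : ∀ k (i : Fin k) a b {M N P : Matrix k} → AgreeOffRow i M P → AgreeOffRow i N P →
               (∀ c → P i c ≈ a * M i c + b * N i c) → det k P ≈ a * det k M + b * det k N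
  det-linear (suc k) zero a b {M} {N} {P} M~P N~P rowP = det-linear-termwise a b {M} {N} {P} λ j → begin
    (sign (toℕ j) * P zero j) * det k (minor zero j P)
      ≈⟨ *-cong (*-congˡ (rowP j)) (det-cong k (minorP≈ M~P j)) ⟩
    (sign (toℕ j) * (a * M zero j + b * N zero j)) * det k (minor zero j M)
      ≈⟨ solve 6 (λ s a b m n d → (s :* (a :* m :+ b :* n)) :* d := a :* ((s :* m) :* d) :+ b :* ((s :* n) :* d))
                 refl (sign (toℕ j)) a b (M zero j) (N zero j) _ ⟩
    a * firstRowTerm M j + b * ((sign (toℕ j) * N zero j) * det k (minor zero j M))
      ≈⟨ +-congˡ (*-congˡ (*-congˡ (trans (sym (det-cong k (minorP≈ M~P j))) (det-cong k (minorP≈ N~P j))))) ⟩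
    a * firstRowTerm M j + b * firstRowTerm N j ∎
    where
    minorP≈ : ∀ {X} → AgreeOffRow zero X P → ∀ j r c → minor zero j P r c ≈ minor zero j X r c
    minorP≈ X~P j r c = sym (X~P (suc r) (λ ()) (punchIn j c))
  det-linear (suc k) (suc i) a b {M} {N} {P} M~P N~P rowP = det-linear-termwise a b {M} {N} {P} λ j → begin
    (sign (toℕ j) * P zero j) * det k (minor zero j P)
      ≈⟨ *-congˡ (det-linear k i a b (minor~ M~P j) (minor~ N~P j) (rowP ∘ punchIn j)) ⟩
    (sign (toℕ j) * P zero j) * (a * det k (minor zero j M) + b * det k (minor zero j N))
      ≈⟨ solve 5 (λ q a b x y → q :* (a :* x :+ b :* y) := a :* (q :* x) :+ b :* (q :* y))
                 refl (sign (toℕ j) * P zero j) a b _ _ ⟩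
    a * ((sign (toℕ j) * P zero j) * det k (minor zero j M))
      + b * ((sign (toℕ j) * P zero j) * det k (minor zero j N))
      ≈⟨ +-cong (*-congˡ (*-congʳ (*-congˡ (sym (M~P zero (λ ()) j)))))
                (*-congˡ (*-congʳ (*-congˡ (sym (N~P zero (λ ()) j))))) ⟩
    a * firstRowTerm M j + b * firstRowTerm N j ∎
    where
    minor~ : ∀ {X} → AgreeOffRow (suc i) X P → ∀ j → AgreeOffRow i (minor zero j X) (minor zero j P)
    minor~ X~P j r r≢i c = X~P (suc r) (r≢i ∘ suc-injective) (punchIn j c)

  det-additive : ∀ k (i : Fin k) {M N P : Matrix k} → AgreeOffRow i M P → AgreeOffRow i N P →
                 (∀ c → P i c ≈ M i c + N i c) → det k P ≈ det k M + det k N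
  det-additive k i M~P N~P rowP = begin
    _                        ≈⟨ det-linear k i 1# 1# M~P N~P (λ c → trans (rowP c) (sym (+-cong (*-identityˡ _) (*-identityˡ _)))) ⟩
    1# * _ + 1# * _          ≈⟨ +-cong (*-identityˡ _) (*-identityˡ _) ⟩
    _                        ∎

  Alternating : ℕ → Set (c ⊔ ℓ)
  Alternating k = ∀ (M : Matrix k) p q → p ≢ q → (∀ c → M p c ≈ M q c) → det k M ≈ 0#

  record RowSwap {k} (p q : Fin k) (M M′ : Matrix k) : Set ℓ where
    field
      at-p  : ∀ c → M′ p c ≈ M q c
      at-q  : ∀ c → M′ q c ≈ M p c
      other : ∀ r → r ≢ p → r ≢ q → ∀ c → M′ r c ≈ M r c

  replaceRow : Matrix k → Fin k → (Fin k → Carrier) → Matrix k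
  replaceRow M i x = updateAt M i (λ _ → x)

  replaceRow-at : ∀ (M : Matrix k) i x c → replaceRow M i x i c ≈ x c
  replaceRow-at M i x c = reflexive (≡.cong (_$ c) (updateAt-updates i M))

  replaceRow-off : ∀ (M : Matrix k) i x r → r ≢ i → ∀ c → replaceRow M i x r c ≈ M r c
  replaceRow-off M i x r r≢i c = reflexive (≡.cong (_$ c) (updateAt-minimal r i M r≢i))

  det-swap : ∀ k → Alternating k → ∀ {p q} {M M′ : Matrix k} → p ≢ q → RowSwap p q M M′ →
             det k M′ ≈ - det k M
  det-swap k alt {p} {q} {M} {M′} p≢q swap = inverseʳ-unique (det k M) (det k M′) (begin
    det k M + det k M′
      ≈⟨ +-cong (sym (det-cong k (N≈ M (λ _ → refl) (λ _ → refl) (λ _ _ _ _ → refl))))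
                (sym (det-cong k (N≈ M′ (sym ∘ at-p) (sym ∘ at-q) (λ r r≢p r≢q c → sym (other r r≢p r≢q c))))) ⟩
    f (M p) (M q) + f (M q) (M p)
      ≈⟨ +-cong (sym (+-identityˡ _)) (sym (+-identityʳ _)) ⟩
    (0# + f (M p) (M q)) + (f (M q) (M p) + 0#)
      ≈⟨ +-cong (+-congʳ (sym (f-diag (M p)))) (+-congˡ (sym (f-diag (M q)))) ⟩
    (f (M p) (M p) + f (M p) (M q)) + (f (M q) (M p) + f (M q) (M q))
      ≈⟨ +-cong (sym (f-additiveʳ (M p) (M p) (M q))) (sym (f-additiveʳ (M q) (M p) (M q))) ⟩
    f (M p) s + f (M q) s
      ≈⟨ sym (f-additiveˡ (M p) (M q) s) ⟩
    f s s
      ≈⟨ f-diag s ⟩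
    0# ∎)
    where
    open RowSwap swap
    s : Fin k → Carrier
    s c = M p c + M q c
    N : (x y : Fin k → Carrier) → Matrix k
    N x y = replaceRow (replaceRow M p x) q y
    f : (x y : Fin k → Carrier) → Carrier
    f x y = det k (N x y)
    N-at-q : ∀ x y c → N x y q c ≈ y c
    N-at-q x y = replaceRow-at _ q y
    N-at-p : ∀ x y c → N x y p c ≈ x c
    N-at-p x y c = trans (replaceRow-off _ q y p p≢q c) (replaceRow-at M p x c)
    N≈ : ∀ {x y} (P : Matrix k) → (∀ c → x c ≈ P p c) → (∀ c → y c ≈ P q c) →
         (∀ r → r ≢ p → r ≢ q → ∀ c → M r c ≈ P r c) → ∀ r c → N x y r c ≈ P r c
    N≈ {x} {y} P xp yq others r c with r ≟F q | r ≟F p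
    ... | yes ≡.refl | _          = trans (N-at-q x y c) (yq c)
    ... | no _       | yes ≡.refl = trans (N-at-p x y c) (xp c)
    ... | no r≢q     | no r≢p     = trans (replaceRow-off _ q y r r≢q c)
                                          (trans (replaceRow-off M p x r r≢p c) (others r r≢p r≢q c))
    N-off-p : ∀ x x′ y → AgreeOffRow p (N x y) (N x′ y)
    N-off-p x x′ y r r≢p c with r ≟F q
    ... | yes ≡.refl = trans (N-at-q x y c) (sym (N-at-q x′ y c))
    ... | no r≢q     = trans (replaceRow-off _ q y r r≢q c)
                         (trans (replaceRow-off M p x r r≢p c)
                           (sym (trans (replaceRow-off _ q y r r≢q c) (replaceRow-off M p x′ r r≢p c))))
    N-off-q : ∀ x y y′ → AgreeOffRow q (N x y) (N x y′)
    N-off-q x y y′ r r≢q c = trans (replaceRow-off _ q y r r≢q c) (sym (replaceRow-off _ q y′ r r≢q c))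
    f-diag : ∀ x → f x x ≈ 0#
    f-diag x = alt (N x x) p q p≢q (λ c → trans (N-at-p x x c) (sym (N-at-q x x c)))
    f-additiveˡ : ∀ x x′ y → f (λ c → x c + x′ c) y ≈ f x y + f x′ y
    f-additiveˡ x x′ y = det-additive k p (N-off-p x _ y) (N-off-p x′ _ y)
      (λ c → trans (N-at-p _ y c) (sym (+-cong (N-at-p x y c) (N-at-p x′ y c))))
    f-additiveʳ : ∀ x y y′ → f x (λ c → y c + y′ c) ≈ f x y + f x y′
    f-additiveʳ x y y′ = det-additive k q (N-off-q x y _) (N-off-q x y′ _)
      (λ c → trans (N-at-q x _ c) (sym (+-cong (N-at-q x y c) (N-at-q x y′ c))))

  orderSign : Fin k → Fin k → Carrier
  orderSign zero    zero    = 0#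
  orderSign zero    (suc _) = - 1#
  orderSign (suc _) zero    = 1#
  orderSign (suc a) (suc b) = orderSign a b

  orderSign-refl : (a : Fin k) → orderSign a a ≈ 0#
  orderSign-refl zero    = refl
  orderSign-refl (suc a) = orderSign-refl a

  orderSign-antisym : (a b : Fin k) → orderSign b a ≈ - orderSign a b
  orderSign-antisym zero    zero    = sym -0#≈0#
  orderSign-antisym zero    (suc b) = sym (-‿involutive 1#)
  orderSign-antisym (suc a) zero    = refl
  orderSign-antisym (suc a) (suc b) = orderSign-antisym a b

  sign-punchIn : (j : Fin (suc k)) (l : Fin k) →
                 sign (toℕ (punchIn j l)) * orderSign j (punchIn j l) ≈ sign (toℕ l)
  sign-punchIn zero    l       = solve 1 (λ s → (:- s) :* (:- con (ℤ.+ 1)) := s) refl (sign (toℕ l))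
  sign-punchIn (suc j) zero    = *-identityˡ 1#
  sign-punchIn (suc j) (suc l) = begin
    (- sign (toℕ (punchIn j l))) * orderSign j (punchIn j l)  ≈⟨ solve 2 (λ s o → (:- s) :* o := :- (s :* o)) refl _ _ ⟩
    - (sign (toℕ (punchIn j l)) * orderSign j (punchIn j l))  ≈⟨ -‿cong (sign-punchIn j l) ⟩
    - sign (toℕ l)                                            ∎

  -- A total version of punchOut: the value on the diagonal is irrelevant.
  punchOut′ : Fin (suc (suc k)) → Fin (suc (suc k)) → Fin (suc k)
  punchOut′         zero    zero    = zero
  punchOut′         zero    (suc c) = c
  punchOut′         (suc j) zero    = zero
  punchOut′ {zero}  (suc j) (suc c) = zero
  punchOut′ {suc k} (suc j) (suc c) = suc (punchOut′ j c)

  punchOut′-punchIn : (j : Fin (suc (suc k))) (l : Fin (suc k)) → punchOut′ j (punchIn j l) ≡ l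
  punchOut′-punchIn         zero    l       = ≡.refl
  punchOut′-punchIn         (suc j) zero    = ≡.refl
  punchOut′-punchIn {suc k} (suc j) (suc l) = ≡.cong suc (punchOut′-punchIn j l)

  punchIn-punchOut′-comm : (c c′ : Fin (suc (suc k))) → c ≢ c′ → (b : Fin k) →
    punchIn c (punchIn (punchOut′ c c′) b) ≡ punchIn c′ (punchIn (punchOut′ c′ c) b)
  punchIn-punchOut′-comm         zero    zero     c≢c′ b       = ⊥-elim (c≢c′ ≡.refl)
  punchIn-punchOut′-comm         zero    (suc c′) c≢c′ b       = ≡.refl
  punchIn-punchOut′-comm         (suc c) zero     c≢c′ b       = ≡.refl
  punchIn-punchOut′-comm {suc k} (suc c) (suc c′) c≢c′ zero    = ≡.refl
  punchIn-punchOut′-comm {suc k} (suc c) (suc c′) c≢c′ (suc b) =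
    ≡.cong suc (punchIn-punchOut′-comm c c′ (c≢c′ ∘ ≡.cong suc) b)

  sumF-antisymmetric : (G : Fin k → Fin k → Carrier) → (∀ j c → G c j ≈ - G j c) →
                       sumF (λ j → sumF (G j)) ≈ 0#
  sumF-antisymmetric G anti = x+x≈0⇒x≈0 _ (begin
    S + S                                   ≈⟨ +-congʳ (sumF-comm G) ⟩
    sumF (λ c → sumF (λ j → G j c)) + S     ≈⟨ +-congʳ (sumF-cong (λ c → sumF-cong (λ j → anti c j))) ⟩
    sumF (λ c → sumF (λ j → - G c j)) + S   ≈⟨ +-congʳ (sumF-cong (λ c → sumF-neg (G c))) ⟩
    sumF (λ c → - sumF (G c)) + S           ≈⟨ +-congʳ (sumF-neg (λ c → sumF (G c))) ⟩
    - S + S                                 ≈⟨ -‿inverseˡ S ⟩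
    0#                                      ∎)
    where
    S = sumF (λ j → sumF (G j))

  -- Expanding along the first two rows, the term for columns j (row 0) and c (row 1)
  -- is G j c; swapping j and c only flips the orderSign, so the terms cancel in pairs.
  det-equal-rows01 : ∀ k (M : Matrix (suc (suc k))) → (∀ c → M zero c ≈ M (suc zero) c) →
                   det (suc (suc k)) M ≈ 0#
  det-equal-rows01 k M rows≈ = begin
    det (suc (suc k)) M                          ≈⟨ sumF-cong (λ j → expand j) ⟩
    sumF (λ j → sumF (λ l → G j (punchIn j l)))  ≈⟨ sumF-cong (λ j → sym (drop-diagonal j)) ⟩
    sumF (λ j → sumF (G j))                      ≈⟨ sumF-antisymmetric G G-antisym ⟩
    0#                                           ∎
    where
    sg : ∀ {n} → Fin n → Carrier
    sg j = sign (toℕ j)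
    x : Fin (suc (suc k)) → Carrier
    x = M zero
    minor₂ : Fin (suc (suc k)) → Fin (suc k) → Matrix k
    minor₂ j l a b = M (suc (suc a)) (punchIn j (punchIn l b))
    G : Fin (suc (suc k)) → Fin (suc (suc k)) → Carrier
    G j c = ((sg j * sg c) * orderSign j c) * ((x j * x c) * det k (minor₂ j (punchOut′ j c)))
    expand : ∀ j → firstRowTerm M j ≈ sumF (λ l → G j (punchIn j l))
    expand j = begin
      (sg j * x j) * sumF (λ l → (sg l * M (suc zero) (punchIn j l)) * det k (minor₂ j l))
        ≈⟨ *-distribˡ-sumF (sg j * x j) (λ l → (sg l * M (suc zero) (punchIn j l)) * det k (minor₂ j l)) ⟩
      sumF (λ l → (sg j * x j) * ((sg l * M (suc zero) (punchIn j l)) * det k (minor₂ j l)))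
        ≈⟨ sumF-cong term ⟩
      sumF (λ l → G j (punchIn j l)) ∎
      where
      term : ∀ l → (sg j * x j) * ((sg l * M (suc zero) (punchIn j l)) * det k (minor₂ j l))
                   ≈ G j (punchIn j l)
      term l = begin
        (sg j * x j) * ((sg l * M (suc zero) (punchIn j l)) * det k (minor₂ j l))
          ≈⟨ *-congˡ (*-congʳ (*-cong (sym (sign-punchIn j l)) (sym (rows≈ (punchIn j l))))) ⟩
        (sg j * x j) * (((sg (punchIn j l) * orderSign j (punchIn j l)) * x (punchIn j l)) * det k (minor₂ j l))
          ≈⟨ solve 6 (λ a b c d e f → (a :* b) :* (((c :* d) :* e) :* f) := ((a :* c) :* d) :* ((b :* e) :* f))
                     refl _ _ _ _ _ _ ⟩
        ((sg j * sg (punchIn j l)) * orderSign j (punchIn j l)) * ((x j * x (punchIn j l)) * det k (minor₂ j l))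
          ≡⟨ ≡.cong (λ l′ → ((sg j * sg (punchIn j l)) * orderSign j (punchIn j l))
                             * ((x j * x (punchIn j l)) * det k (minor₂ j l′))) (punchOut′-punchIn j l) ⟨
        G j (punchIn j l) ∎
    G-diagonal : ∀ j → G j j ≈ 0#
    G-diagonal j = trans (*-congʳ (trans (*-congˡ (orderSign-refl j)) (zeroʳ _))) (zeroˡ _)
    drop-diagonal : ∀ j → sumF (G j) ≈ sumF (λ l → G j (punchIn j l))
    drop-diagonal j = trans (sumF-remove (G j) j)
                            (trans (+-congʳ (G-diagonal j)) (+-identityˡ _))
    G-antisym : ∀ j c → G c j ≈ - G j c
    G-antisym j c with c ≟F j
    ... | yes ≡.refl = trans (G-diagonal c) (sym (trans (-‿cong (G-diagonal c)) -0#≈0#))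
    ... | no c≢j = begin
      ((sg c * sg j) * orderSign c j) * ((x c * x j) * det k (minor₂ c (punchOut′ c j)))
        ≈⟨ *-cong (*-congˡ (orderSign-antisym j c))
                  (*-congˡ (det-cong k (λ a b → reflexive (≡.cong (M (suc (suc a)))
                                                              (punchIn-punchOut′-comm c j c≢j b))))) ⟩
      ((sg c * sg j) * (- orderSign j c)) * ((x c * x j) * det k (minor₂ j (punchOut′ j c)))
        ≈⟨ solve 6 (λ a b o p q d → ((a :* b) :* (:- o)) :* ((p :* q) :* d) := :- (((b :* a) :* o) :* ((q :* p) :* d)))
                   refl _ _ _ _ _ _ ⟩
      - G j c ∎

  swapRows : Matrix k → Fin k → Fin k → Matrix k
  swapRows M p q = replaceRow (replaceRow M p (M q)) q (M p)

  swapRows-RowSwap : ∀ (M : Matrix k) {p q} → p ≢ q → RowSwap p q M (swapRows M p q)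
  swapRows-RowSwap M {p} {q} p≢q = record
    { at-p  = λ c → trans (replaceRow-off _ q (M p) p p≢q c) (replaceRow-at M p (M q) c)
    ; at-q  = replaceRow-at _ q (M p)
    ; other = λ r r≢p r≢q c → trans (replaceRow-off _ q (M p) r r≢q c) (replaceRow-off M p (M q) r r≢p c)
    }

  det-swap-suc : ∀ k → Alternating k → ∀ {p q} {M M′ : Matrix (suc k)} → p ≢ q →
                   RowSwap (suc p) (suc q) M M′ → det (suc k) M′ ≈ - det (suc k) M
  det-swap-suc k alt {p} {q} {M} {M′} p≢q swap = trans (sumF-cong term) (sumF-neg (firstRowTerm M))
    where
    open RowSwap swap
    minor-swap : ∀ j → RowSwap p q (minor zero j M) (minor zero j M′)
    minor-swap j = record
      { at-p  = at-p ∘ punchIn j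
      ; at-q  = at-q ∘ punchIn j
      ; other = λ r r≢p r≢q c → other (suc r) (r≢p ∘ suc-injective) (r≢q ∘ suc-injective) (punchIn j c)
      }
    term : ∀ j → firstRowTerm M′ j ≈ - firstRowTerm M j
    term j = begin
      (sign (toℕ j) * M′ zero j) * det k (minor zero j M′)
        ≈⟨ *-cong (*-congˡ (other zero (λ ()) (λ ()) j)) (det-swap k alt p≢q (minor-swap j)) ⟩
      (sign (toℕ j) * M zero j) * - det k (minor zero j M)
        ≈⟨ solve 2 (λ a b → a :* (:- b) := :- (a :* b)) refl _ _ ⟩
      - firstRowTerm M j ∎

  det-equal-row0 : ∀ k → Alternating (suc k) → ∀ (M : Matrix (suc (suc k))) q →
              (∀ c → M zero c ≈ M (suc q) c) → det (suc (suc k)) M ≈ 0#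
  det-equal-row0 k alt M zero    rows≈ = det-equal-rows01 k M rows≈
  det-equal-row0 k alt M (suc q) rows≈ = begin
    det (suc (suc k)) M    ≈⟨ -‿involutive _ ⟨
    - - det (suc (suc k)) M ≈⟨ -‿cong (det-swap-suc (suc k) alt 0≢1+q swap) ⟨
    - det (suc (suc k)) M′ ≈⟨ -‿cong (det-equal-rows01 k M′ (λ c → trans (other zero (λ ()) (λ ()) c)
                                                              (trans (rows≈ c) (sym (at-p c))))) ⟩
    - 0#                   ≈⟨ -0#≈0# ⟩
    0#                     ∎
    where
    0≢1+q : zero ≢ suc q
    0≢1+q ()
    M′ = swapRows M (suc zero) (suc (suc q))
    swap = swapRows-RowSwap M (λ ())
    open RowSwap swap

  det-alternating : ∀ k → Alternating k
  det-alternating (suc zero)    M zero    zero    p≢q rows≈ = ⊥-elim (p≢q ≡.refl)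
  det-alternating (suc (suc k)) M zero    zero    p≢q rows≈ = ⊥-elim (p≢q ≡.refl)
  det-alternating (suc (suc k)) M zero    (suc q) p≢q rows≈ =
    det-equal-row0 k (det-alternating (suc k)) M q rows≈
  det-alternating (suc (suc k)) M (suc p) zero    p≢q rows≈ =
    det-equal-row0 k (det-alternating (suc k)) M p (sym ∘ rows≈)
  det-alternating (suc (suc k)) M (suc p) (suc q) p≢q rows≈ = sumF-zero (firstRowTerm M) λ j →
    trans (*-congˡ (det-alternating (suc k) (minor zero j M) p q (p≢q ∘ ≡.cong suc) (rows≈ ∘ punchIn j)))
          (zeroʳ _)

  cofactor : Matrix (suc k) → Fin (suc k) → Fin (suc k) → Carrier
  cofactor {k} M i j = sign (toℕ i ℕ.+ toℕ j) * det k (minor i j M)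

  LaplaceAlong : ∀ k → Fin (suc k) → Set (c ⊔ ℓ)
  LaplaceAlong k i = ∀ (M : Matrix (suc k)) → det (suc k) M ≈ sumF (λ j → M i j * cofactor M i j)

  swapAdjacent : Fin k → Fin (suc k) → Fin (suc k)
  swapAdjacent zero    zero          = suc zero
  swapAdjacent zero    (suc zero)    = zero
  swapAdjacent zero    (suc (suc r)) = suc (suc r)
  swapAdjacent (suc i) zero          = zero
  swapAdjacent (suc i) (suc r)       = suc (swapAdjacent i r)

  swapAdjacent-inject₁ : (i : Fin k) → swapAdjacent i (inject₁ i) ≡ suc i
  swapAdjacent-inject₁ zero    = ≡.refl
  swapAdjacent-inject₁ (suc i) = ≡.cong suc (swapAdjacent-inject₁ i)

  swapAdjacent-suc : (i : Fin k) → swapAdjacent i (suc i) ≡ inject₁ i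
  swapAdjacent-suc zero    = ≡.refl
  swapAdjacent-suc (suc i) = ≡.cong suc (swapAdjacent-suc i)

  swapAdjacent-other : (i : Fin k) (r : Fin (suc k)) → r ≢ inject₁ i → r ≢ suc i → swapAdjacent i r ≡ r
  swapAdjacent-other zero    zero          r≢i r≢1+i = ⊥-elim (r≢i ≡.refl)
  swapAdjacent-other zero    (suc zero)    r≢i r≢1+i = ⊥-elim (r≢1+i ≡.refl)
  swapAdjacent-other zero    (suc (suc r)) r≢i r≢1+i = ≡.refl
  swapAdjacent-other (suc i) zero          r≢i r≢1+i = ≡.refl
  swapAdjacent-other (suc i) (suc r)       r≢i r≢1+i =
    ≡.cong suc (swapAdjacent-other i r (r≢i ∘ ≡.cong suc) (r≢1+i ∘ ≡.cong suc))

  swapAdjacent-punchIn : (i a : Fin k) → swapAdjacent i (punchIn (inject₁ i) a) ≡ punchIn (suc i) a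
  swapAdjacent-punchIn zero    zero    = ≡.refl
  swapAdjacent-punchIn zero    (suc a) = ≡.refl
  swapAdjacent-punchIn (suc i) zero    = ≡.refl
  swapAdjacent-punchIn (suc i) (suc a) = ≡.cong suc (swapAdjacent-punchIn i a)

  inject₁≢suc : (i : Fin k) → inject₁ i ≢ suc i
  inject₁≢suc zero    ()
  inject₁≢suc (suc i) eq = inject₁≢suc i (suc-injective eq)

  laplace-zero : LaplaceAlong k zero
  laplace-zero {k} M = sumF-cong λ j →
    solve 3 (λ s m d → (s :* m) :* d := m :* (s :* d)) refl (sign (toℕ j)) (M zero j) (det k (minor zero j M))

  laplace-suc : ∀ k (i : Fin k) → LaplaceAlong k (inject₁ i) → LaplaceAlong k (suc i)
  laplace-suc k i laplace-i M = begin
    det (suc k) M                 ≈⟨ -‿involutive _ ⟨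
    - - det (suc k) M             ≈⟨ -‿cong (det-swap (suc k) (det-alternating (suc k)) (inject₁≢suc i) swap) ⟨
    - det (suc k) M′              ≈⟨ -‿cong (laplace-i M′) ⟩
    - sumF (λ j → M′ (inject₁ i) j * cofactor M′ (inject₁ i) j)
      ≈⟨ sumF-neg (λ j → M′ (inject₁ i) j * cofactor M′ (inject₁ i) j) ⟨
    sumF (λ j → - (M′ (inject₁ i) j * cofactor M′ (inject₁ i) j)) ≈⟨ sumF-cong term ⟨
    sumF (λ j → M (suc i) j * cofactor M (suc i) j)               ∎
    where
    M′ : Matrix (suc k)
    M′ r = M (swapAdjacent i r)
    at : ∀ {r r′} → swapAdjacent i r ≡ r′ → ∀ c → M′ r c ≈ M r′ c
    at eq c = reflexive (≡.cong (λ r → M r c) eq)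
    swap : RowSwap (inject₁ i) (suc i) M M′
    swap = record
      { at-p  = at (swapAdjacent-inject₁ i)
      ; at-q  = at (swapAdjacent-suc i)
      ; other = λ r r≢i r≢1+i → at (swapAdjacent-other i r r≢i r≢1+i)
      }
    term : ∀ j → M (suc i) j * cofactor M (suc i) j ≈ - (M′ (inject₁ i) j * cofactor M′ (inject₁ i) j)
    term j = begin
      M (suc i) j * ((- sign (toℕ i ℕ.+ toℕ j)) * det k (minor (suc i) j M))
        ≈⟨ solve 3 (λ m s d → m :* ((:- s) :* d) := :- (m :* (s :* d))) refl _ _ _ ⟩
      - (M (suc i) j * (sign (toℕ i ℕ.+ toℕ j) * det k (minor (suc i) j M)))
        ≈⟨ -‿cong (*-cong (sym (at (swapAdjacent-inject₁ i) j))
                          (*-cong (reflexive (≡.cong (λ n → sign (n ℕ.+ toℕ j)) (≡.sym (toℕ-inject₁ i))))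
                                  (det-cong k (λ a b → sym (at (swapAdjacent-punchIn i a) (punchIn j b)))))) ⟩
      - (M′ (inject₁ i) j * cofactor M′ (inject₁ i) j) ∎

  laplace : ∀ k (i : Fin (suc k)) → LaplaceAlong k i
  laplace k = <-weakInduction (LaplaceAlong k) laplace-zero (laplace-suc k)

  cofactor-replaceRow : ∀ (M : Matrix (suc k)) i x j → cofactor (replaceRow M i x) i j ≈ cofactor M i j
  cofactor-replaceRow {k} M i x j = *-congˡ (det-cong k λ a b →
    replaceRow-off M i x (punchIn i a) (punchInᵢ≢i i a) (punchIn j b))

  laplace-replaceRow : ∀ k (M : Matrix (suc k)) i x →
                       det (suc k) (replaceRow M i x) ≈ sumF (λ j → x j * cofactor M i j)
  laplace-replaceRow k M i x = trans (laplace k i (replaceRow M i x)) (sumF-cong λ j →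
    *-cong (replaceRow-at M i x j) (cofactor-replaceRow M i x j))

  adjugate-diagonal : ∀ k (M : Matrix (suc k)) i → sumF (λ j → M i j * cofactor M i j) ≈ det (suc k) M
  adjugate-diagonal k M i = sym (laplace k i M)

  adjugate-offDiagonal : ∀ k (M : Matrix (suc k)) r i → r ≢ i →
                         sumF (λ j → M r j * cofactor M i j) ≈ 0#
  adjugate-offDiagonal k M r i r≢i = trans (sym (laplace-replaceRow k M i (M r)))
    (det-alternating (suc k) (replaceRow M i (M r)) i r (r≢i ∘ ≡.sym) λ c →
      trans (replaceRow-at M i (M r) c) (sym (replaceRow-off M i (M r) r r≢i c)))

  ones : Fin k → Carrier
  ones _ = 1#

  cof≈sum-det-replaceRow-ones : ∀ k (A : Matrix (suc k)) →
                                cof k A ≈ sumF (λ i → det (suc k) (replaceRow A i ones))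
  cof≈sum-det-replaceRow-ones k A = sumF-cong λ i → sym (trans (laplace-replaceRow k A i ones)
                                                                 (sumF-cong {g = cofactor A i} (λ j → *-identityˡ _)))

  private
    sumF-quadratic : ∀ t (X Y W : Fin k → Carrier) →
      sumF (λ j → X j + (t * Y j + t * (t * W j))) ≈ sumF X + (t * sumF Y + t * (t * sumF W))
    sumF-quadratic t X Y W = begin
      sumF (λ j → X j + (t * Y j + t * (t * W j)))
        ≈⟨ trans (sumF-distrib-+ X _) (+-congˡ (sumF-distrib-+ (λ j → t * Y j) (λ j → t * (t * W j)))) ⟩
      sumF X + (sumF (λ j → t * Y j) + sumF (λ j → t * (t * W j)))
        ≈⟨ +-congˡ (+-cong (sym (*-distribˡ-sumF t Y))
                           (trans (sym (*-distribˡ-sumF t (λ j → t * W j))) (*-congˡ (sym (*-distribˡ-sumF t W))))) ⟩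
      sumF X + (t * sumF Y + t * (t * sumF W)) ∎

    minor-replaceRow : ∀ (A : Matrix (suc (suc k))) b j r c →
      replaceRow (minor zero j A) b ones r c ≈ minor zero j (replaceRow A (suc b) ones) r c
    minor-replaceRow A b j r c with r ≟F b
    ... | yes ≡.refl = trans (replaceRow-at _ r ones c) (sym (replaceRow-at A (suc r) ones (punchIn j c)))
    ... | no r≢b     = trans (replaceRow-off _ b ones r r≢b c)
                             (sym (replaceRow-off A (suc b) ones (suc r) (r≢b ∘ suc-injective) (punchIn j c)))

  -- Expand along the first row and use induction on the minors; the t² terms are first-row
  -- expansions of matrices with two rows of ones, hence vanish.
  det-addConstant′ : ∀ k (A : Matrix (suc k)) t →
    det (suc k) (addConstant A t) ≈ det (suc k) A + t * sumF (λ i → det (suc k) (replaceRow A i ones))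
  det-addConstant′ zero    A t = solve 2 (λ a t → (con (ℤ.+ 1) :* (a :+ t)) :* con (ℤ.+ 1) :+ con (ℤ.+ 0)
      := ((con (ℤ.+ 1) :* a) :* con (ℤ.+ 1) :+ con (ℤ.+ 0))
         :+ t :* (((con (ℤ.+ 1) :* con (ℤ.+ 1)) :* con (ℤ.+ 1) :+ con (ℤ.+ 0)) :+ con (ℤ.+ 0)))
    refl (A zero zero) t
  det-addConstant′ (suc k) A t = begin
    det (suc (suc k)) (addConstant A t)
      ≈⟨ laplace (suc k) zero (addConstant A t) ⟩
    sumF (λ j → (a j + t) * (s j * det (suc k) (addConstant (minor zero j A) t)))
      ≈⟨ sumF-cong term ⟩
    sumF (λ j → a j * κ j + (t * (κ j + a j * σ j) + t * (t * σ j)))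
      ≈⟨ sumF-quadratic t (λ j → a j * κ j) (λ j → κ j + a j * σ j) σ ⟩
    sumF (λ j → a j * κ j) + (t * sumF (λ j → κ j + a j * σ j) + t * (t * sumF σ))
      ≈⟨ +-cong (sym (laplace (suc k) zero A))
                (+-cong (*-congˡ (trans (sumF-distrib-+ κ (λ j → a j * σ j)) (+-cong Σκ Σaσ)))
                        (*-congˡ (trans (*-congˡ Σσ) (zeroʳ t)))) ⟩
    det (suc (suc k)) A + (t * sumF (λ i → det (suc (suc k)) (replaceRow A i ones)) + t * 0#)
      ≈⟨ +-congˡ (trans (+-congˡ (zeroʳ t)) (+-identityʳ _)) ⟩
    det (suc (suc k)) A + t * sumF (λ i → det (suc (suc k)) (replaceRow A i ones)) ∎
    where
    s : Fin (suc (suc k)) → Carrier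
    s j = sign (toℕ j)
    a : Fin (suc (suc k)) → Carrier
    a = A zero
    κ : Fin (suc (suc k)) → Carrier
    κ = cofactor A zero
    Aᵇ : Fin (suc k) → Matrix (suc (suc k))
    Aᵇ b = replaceRow A (suc b) ones
    σ : Fin (suc (suc k)) → Carrier
    σ j = s j * sumF (λ b → det (suc k) (minor zero j (Aᵇ b)))
    term : ∀ j → (a j + t) * (s j * det (suc k) (addConstant (minor zero j A) t))
                 ≈ a j * κ j + (t * (κ j + a j * σ j) + t * (t * σ j))
    term j = begin
      (a j + t) * (s j * det (suc k) (addConstant (minor zero j A) t))
        ≈⟨ *-congˡ (*-congˡ (det-addConstant′ k (minor zero j A) t)) ⟩
      (a j + t) * (s j * (det (suc k) (minor zero j A) + t * sumF (λ b → det (suc k) (replaceRow (minor zero j A) b ones))))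
        ≈⟨ *-congˡ (*-congˡ (+-congˡ (*-congˡ (sumF-cong λ b → det-cong (suc k) (minor-replaceRow A b j))))) ⟩
      (a j + t) * (s j * (det (suc k) (minor zero j A) + t * sumF (λ b → det (suc k) (minor zero j (Aᵇ b)))))
        ≈⟨ solve 5 (λ a t s d C → (a :+ t) :* (s :* (d :+ t :* C))
                       := a :* (s :* d) :+ (t :* (s :* d :+ a :* (s :* C)) :+ t :* (t :* (s :* C))))
                   refl (a j) t (s j) _ _ ⟩
      a j * κ j + (t * (κ j + a j * σ j) + t * (t * σ j)) ∎
    Σκ : sumF κ ≈ det (suc (suc k)) (replaceRow A zero ones)
    Σκ = sym (trans (laplace-replaceRow (suc k) A zero ones) (sumF-cong (λ j → *-identityˡ (κ j))))
    expand : (x : Fin (suc (suc k)) → Carrier) →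
             sumF (λ j → x j * σ j) ≈ sumF (λ b → sumF (λ j → x j * cofactor (Aᵇ b) zero j))
    expand x = begin
      sumF (λ j → x j * σ j)
        ≈⟨ sumF-cong (λ j → trans (*-congˡ (*-distribˡ-sumF (s j) (λ b → det (suc k) (minor zero j (Aᵇ b)))))
                                  (*-distribˡ-sumF (x j) (λ b → s j * det (suc k) (minor zero j (Aᵇ b))))) ⟩
      sumF (λ j → sumF (λ b → x j * (s j * det (suc k) (minor zero j (Aᵇ b)))))
        ≈⟨ sumF-comm (λ j b → x j * cofactor (Aᵇ b) zero j) ⟩
      sumF (λ b → sumF (λ j → x j * cofactor (Aᵇ b) zero j)) ∎
    Σaσ : sumF (λ j → a j * σ j) ≈ sumF (λ b → det (suc (suc k)) (Aᵇ b))
    Σaσ = trans (expand a) (sumF-cong λ b → trans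
      (sumF-cong {g = λ j → Aᵇ b zero j * cofactor (Aᵇ b) zero j}
                 (λ j → *-congʳ (sym (replaceRow-off A (suc b) ones zero (λ ()) j))))
      (sym (laplace (suc k) zero (Aᵇ b))))
    Σσ : sumF σ ≈ 0#
    Σσ = trans (sumF-cong {f = σ} (λ j → sym (*-identityˡ (σ j)))) (trans (expand ones) (sumF-zero _ λ b →
      trans (sym (laplace-replaceRow (suc k) (Aᵇ b) zero ones))
            (det-alternating (suc (suc k)) (replaceRow (Aᵇ b) zero ones) zero (suc b) (λ ()) λ c →
               trans (replaceRow-at (Aᵇ b) zero ones c)
                     (sym (trans (replaceRow-off (Aᵇ b) zero ones (suc b) (λ ()) c) (replaceRow-at A (suc b) ones c))))))

  det-addConstant : ∀ k (A : Matrix (suc k)) t → det (suc k) (addConstant A t) ≈ det (suc k) A + t * cof k A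
  det-addConstant k A t = trans (det-addConstant′ k A t) (+-congˡ (*-congˡ (sym (cof≈sum-det-replaceRow-ones k A))))

  Anisotropic : Matrix k → Set (c ⊔ ℓ)
  Anisotropic M = ∀ x i → ¬ (x i ≈ 0#) → ¬ (quadForm M x ≈ 0#)

  private
    anisotropic-minor : ∀ (M : Matrix (suc k)) → Anisotropic M → Anisotropic (minor zero zero M)
    anisotropic-minor {k} M aniso y i yᵢ≉0 qy≈0 = aniso x (suc i) yᵢ≉0 (trans qx≈qy qy≈0)
      where
      x : Fin (suc k) → Carrier
      x zero    = 0#
      x (suc a) = y a
      qx≈qy : quadForm M x ≈ quadForm (minor zero zero M) y
      qx≈qy = begin
        sumF (λ j → (0# * M zero j) * x j) + sumF (λ a → sumF (λ j → (y a * M (suc a) j) * x j))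
          ≈⟨ +-cong (sumF-zero (λ j → (0# * M zero j) * x j) (λ j → trans (*-congʳ (zeroˡ _)) (zeroˡ _)))
                    (sumF-cong {g = λ a → sumF (λ b → (y a * M (suc a) (suc b)) * y b)}
                               (λ a → trans (+-congʳ (zeroʳ _)) (+-identityˡ _))) ⟩
        0# + quadForm (minor zero zero M) y
          ≈⟨ +-identityˡ _ ⟩
        quadForm (minor zero zero M) y ∎

  -- The first row of the adjugate lies in the kernel of M when det M ≈ 0.
  det-anisotropic : ¬ (0# ≈ 1#) → ∀ k (M : Matrix k) → Anisotropic M → ¬ (det k M ≈ 0#)
  det-anisotropic 0≉1 zero    M aniso det≈0 = 0≉1 (sym det≈0)
  det-anisotropic 0≉1 (suc k) M aniso det≈0 = aniso x zero x₀≉0 (trans (bilinear≈dot-*ᵥ M x x)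
    (sumF-zero (λ i → x i * (M *ᵥ x) i) λ i → trans (*-congˡ (Mx≈0 i)) (zeroʳ _)))
    where
    x : Fin (suc k) → Carrier
    x = cofactor M zero
    Mx≈0 : ∀ r → (M *ᵥ x) r ≈ 0#
    Mx≈0 zero    = trans (adjugate-diagonal k M zero) det≈0
    Mx≈0 (suc r) = adjugate-offDiagonal k M (suc r) zero (λ ())
    x₀≉0 : ¬ (x zero ≈ 0#)
    x₀≉0 x₀≈0 = det-anisotropic 0≉1 k (minor zero zero M) (anisotropic-minor M aniso)
                  (trans (sym (*-identityˡ _)) x₀≈0)

  -- Cramer's rule: x = δ · adj(M) b.
  solve-linear : ∀ k (M : Matrix (suc k)) (δ : Carrier) → δ * det (suc k) M ≈ 1# →
                 ∀ (b : Fin (suc k) → Carrier) → Σ (Fin (suc k) → Carrier) (λ x → ∀ r → (M *ᵥ x) r ≈ b r)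
  solve-linear k M δ δ-inverse b = x , Mx≈b
    where
    x : Fin (suc k) → Carrier
    x j = δ * sumF (λ i → b i * cofactor M i j)
    Mx≈b : ∀ r → (M *ᵥ x) r ≈ b r
    Mx≈b r = begin
      sumF (λ j → M r j * (δ * sumF (λ i → b i * cofactor M i j)))
        ≈⟨ sumF-cong (λ j → trans (*-congˡ (*-distribˡ-sumF δ (λ i → b i * cofactor M i j)))
                                  (*-distribˡ-sumF (M r j) (λ i → δ * (b i * cofactor M i j)))) ⟩
      sumF (λ j → sumF (λ i → M r j * (δ * (b i * cofactor M i j))))
        ≈⟨ sumF-comm (λ j i → M r j * (δ * (b i * cofactor M i j))) ⟩
      sumF (λ i → sumF (λ j → M r j * (δ * (b i * cofactor M i j))))
        ≈⟨ sumF-cong (λ i → trans (sumF-cong λ j → solve 4 (λ m d b c → m :* (d :* (b :* c)) := (d :* b) :* (m :* c))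
                                                             refl (M r j) δ (b i) (cofactor M i j))
                                  (sym (*-distribˡ-sumF (δ * b i) (λ j → M r j * cofactor M i j)))) ⟩
      sumF (λ i → (δ * b i) * sumF (λ j → M r j * cofactor M i j))
        ≈⟨ sumF-δ (λ i → (δ * b i) * sumF (λ j → M r j * cofactor M i j)) r
                  (λ i i≢r → trans (*-congˡ (adjugate-offDiagonal k M r i (i≢r ∘ ≡.sym))) (zeroʳ _)) ⟩
      (δ * b r) * sumF (λ j → M r j * cofactor M r j)
        ≈⟨ *-congˡ (adjugate-diagonal k M r) ⟩
      (δ * b r) * det (suc k) M
        ≈⟨ solve 3 (λ d b m → (d :* b) :* m := b :* (d :* m)) refl δ (b r) (det (suc k) M) ⟩
      b r * (δ * det (suc k) M)
        ≈⟨ *-congˡ δ-inverse ⟩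
      b r * 1#
        ≈⟨ *-identityʳ _ ⟩
      b r ∎

  det-leftKernel : ∀ k (M : Matrix (suc k)) (u : Fin (suc k) → Carrier) →
                   (∀ c → sumF (λ r → u r * M r c) ≈ 0#) → ∀ i → u i * det (suc k) M ≈ 0#
  det-leftKernel k M u uM≈0 i = begin
    u i * det (suc k) M
      ≈⟨ *-congˡ (adjugate-diagonal k M i) ⟨
    u i * sumF (λ j → M i j * cofactor M i j)
      ≈⟨ sumF-δ (λ r → u r * sumF (λ j → M r j * cofactor M i j)) i
                (λ r r≢i → trans (*-congˡ (adjugate-offDiagonal k M r i r≢i)) (zeroʳ _)) ⟨
    sumF (λ r → u r * sumF (λ j → M r j * cofactor M i j))
      ≈⟨ sumF-cong (λ r → trans (*-distribˡ-sumF (u r) (λ j → M r j * cofactor M i j))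
                                (sumF-cong (λ j → sym (*-assoc (u r) (M r j) (cofactor M i j))))) ⟩
    sumF (λ r → sumF (λ j → (u r * M r j) * cofactor M i j))
      ≈⟨ sumF-comm (λ r j → (u r * M r j) * cofactor M i j) ⟩
    sumF (λ j → sumF (λ r → (u r * M r j) * cofactor M i j))
      ≈⟨ sumF-zero (λ j → sumF (λ r → (u r * M r j) * cofactor M i j)) (λ j → trans (sym (*-distribʳ-sumF (cofactor M i j) (λ r → u r * M r j)))
                                  (trans (*-congʳ (uM≈0 j)) (zeroˡ _))) ⟩
    0# ∎

module OrderedFieldProperties {c ℓ₁ ℓ₂} (F : OrderedField c ℓ₁ ℓ₂) where
  open OrderedField F hiding (zero)
  open MatrixDefs commutativeRing using (sumF)
  open FiniteSums commutativeRing
  open IntegerCoefficientSolver commutativeRing using (solve; _:=_; _:+_; _:*_; :-_; con)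
  open IsTotalOrder isTotalOrder public
    using (total; antisym; ≲-respˡ-≈; ≲-respʳ-≈) renaming (refl to ≤-refl; trans to ≤-trans)
  open import Relation.Binary.Reasoning.Setoid setoid

  private
    variable
      k : ℕ

  x*x≥0 : ∀ x → 0# ≤ (x * x)
  x*x≥0 x with total 0# x
  ... | inj₁ 0≤x = *-nonneg 0≤x 0≤x
  ... | inj₂ x≤0 = ≲-respʳ-≈ (solve 1 (λ x → (:- x) :* (:- x) := x :* x) refl x) (*-nonneg 0≤-x 0≤-x)
    where
    0≤-x : 0# ≤ (- x)
    0≤-x = ≲-respʳ-≈ (+-identityˡ _) (≲-respˡ-≈ (-‿inverseʳ x) (+-mono-≤ (- x) x≤0))

  0≤1 : 0# ≤ 1#
  0≤1 = ≲-respʳ-≈ (*-identityˡ 1#) (x*x≥0 1#)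

  0≤1+1 : 0# ≤ (1# + 1#)
  0≤1+1 = ≤-trans 0≤1 (≲-respˡ-≈ (+-identityˡ 1#) (+-mono-≤ 1# 0≤1))

  -x≤0 : ∀ {x} → 0# ≤ x → (- x) ≤ 0#
  -x≤0 {x} 0≤x = ≲-respʳ-≈ (-‿inverseʳ x) (≲-respˡ-≈ (+-identityˡ (- x)) (+-mono-≤ (- x) 0≤x))

  1+1≉0 : ¬ (1# + 1# ≈ 0#)
  1+1≉0 2≈0 = 0≉1 (antisym 0≤1 (≲-respʳ-≈ 2≈0 (≲-respˡ-≈ (+-identityˡ 1#) (+-mono-≤ 1# 0≤1))))

  x+x≈0⇒x≈0 : ∀ x → x + x ≈ 0# → x ≈ 0#
  x+x≈0⇒x≈0 x x+x≈0 with inverse (1# + 1#) 1+1≉0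
  ... | ½ , 2*½≈1 = begin
    x                   ≈⟨ *-identityˡ x ⟨
    1# * x              ≈⟨ *-congʳ 2*½≈1 ⟨
    ((1# + 1#) * ½) * x ≈⟨ solve 2 (λ h x → ((con (ℤ.+ 1) :+ con (ℤ.+ 1)) :* h) :* x := h :* (x :+ x)) refl ½ x ⟩
    ½ * (x + x)         ≈⟨ *-congˡ x+x≈0 ⟩
    ½ * 0#              ≈⟨ zeroʳ ½ ⟩
    0#                  ∎

  x*x≈0⇒¬¬x≈0 : ∀ x → x * x ≈ 0# → ¬ ¬ (x ≈ 0#)
  x*x≈0⇒¬¬x≈0 x x²≈0 x≉0 with inverse x x≉0
  ... | x⁻¹ , x*x⁻¹≈1 = 0≉1 (begin
    0#                  ≈⟨ zeroˡ (x⁻¹ * x⁻¹) ⟨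
    0# * (x⁻¹ * x⁻¹)    ≈⟨ *-congʳ x²≈0 ⟨
    (x * x) * (x⁻¹ * x⁻¹) ≈⟨ solve 2 (λ x y → (x :* x) :* (y :* y) := (x :* y) :* (x :* y)) refl x x⁻¹ ⟩
    (x * x⁻¹) * (x * x⁻¹) ≈⟨ *-cong x*x⁻¹≈1 x*x⁻¹≈1 ⟩
    1# * 1#             ≈⟨ *-identityˡ 1# ⟩
    1#                  ∎)

  sumF-nonneg : (f : Fin k → Carrier) → (∀ i → 0# ≤ f i) → 0# ≤ sumF f
  sumF-nonneg {zero}  f f≥0 = ≤-refl
  sumF-nonneg {suc k} f f≥0 = ≤-trans (≲-respˡ-≈ (+-identityˡ 0#) (+-mono-≤ 0# (f≥0 zero)))
    (≲-respˡ-≈ (+-comm _ _) (≲-respʳ-≈ (+-comm _ _) (+-mono-≤ (f zero) (sumF-nonneg (f ∘ suc) (f≥0 ∘ suc)))))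

  sumF-nonneg-≈0 : (f : Fin k → Carrier) → (∀ i → 0# ≤ f i) → sumF f ≈ 0# → ∀ i → f i ≈ 0#
  sumF-nonneg-≈0 {suc k} f f≥0 Σf≈0 = λ
    { zero    → f₀≈0
    ; (suc i) → sumF-nonneg-≈0 (f ∘ suc) (f≥0 ∘ suc) rest≈0 i }
    where
    rest = sumF (f ∘ suc)
    f₀≤0 : f zero ≤ 0#
    f₀≤0 = ≲-respʳ-≈ Σf≈0 (≲-respˡ-≈ (+-identityʳ _)
             (≲-respˡ-≈ (+-comm _ _) (≲-respʳ-≈ (+-comm _ _) (+-mono-≤ (f zero) (sumF-nonneg (f ∘ suc) (f≥0 ∘ suc))))))
    f₀≈0 : f zero ≈ 0#
    f₀≈0 = antisym f₀≤0 (f≥0 zero)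
    rest≈0 : rest ≈ 0#
    rest≈0 = trans (sym (+-identityˡ rest)) (trans (+-congʳ (sym f₀≈0)) Σf≈0)

  ¬¬-∀-Fin : ∀ {p} (P : Fin k → Set p) → (∀ i → ¬ ¬ P i) → ¬ ¬ (∀ i → P i)
  ¬¬-∀-Fin {zero}  P ¬¬P ¬∀P = ¬∀P (λ ())
  ¬¬-∀-Fin {suc k} P ¬¬P ¬∀P = ¬¬P zero λ P₀ →
    ¬¬-∀-Fin (P ∘ suc) (¬¬P ∘ suc) λ P₊ → ¬∀P λ { zero → P₀ ; (suc i) → P₊ i }

module ConditionallyNegativeDefiniteMatrices {c ℓ₁ ℓ₂} (F : OrderedField c ℓ₁ ℓ₂) where
  open OrderedField F hiding (zero)
  open MatrixDefs commutativeRing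
  open FiniteSums commutativeRing
  open Matrices commutativeRing
  open OrderedFieldProperties F
  open Determinants commutativeRing x+x≈0⇒x≈0
  open IntegerCoefficientSolver commutativeRing using (solve; _:=_; _:+_; _:*_; :-_; _:-_; con)
  open import Relation.Binary.Reasoning.Setoid setoid

  private
    variable
      k : ℕ

  record ConditionallyNegativeDefinite (A : Matrix k) : Set (c ⊔ ℓ₁ ⊔ ℓ₂) where
    field
      nonpositive : ∀ x → sumF x ≈ 0# → quadForm A x ≤ 0#
      definite    : ∀ x → sumF x ≈ 0# → ∀ i → ¬ (x i ≈ 0#) → ¬ (quadForm A x ≈ 0#)

  -- The form of A on the hyperplane Σ x = 0, in the coordinates x₁ … xₖ (with x₀ = - Σ xᵢ).
  compress : Matrix (suc k) → Matrix k
  compress A i j = ((A (suc i) (suc j) - A (suc i) zero) - A zero (suc j)) + A zero zero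

  liftZeroSum : (Fin k → Carrier) → Fin (suc k) → Carrier
  liftZeroSum y zero    = - sumF y
  liftZeroSum y (suc i) = y i

  sumF-liftZeroSum : (y : Fin k → Carrier) → sumF (liftZeroSum y) ≈ 0#
  sumF-liftZeroSum y = -‿inverseˡ (sumF y)

  quadForm-liftZeroSum : ∀ (A : Matrix (suc k)) y → quadForm A (liftZeroSum y) ≈ quadForm (compress A) y
  quadForm-liftZeroSum {k} A y = begin
    (((- S) * a) * (- S) + sumF (λ j → ((- S) * r j) * y j)) + sumF (λ i → (y i * c′ i) * (- S) + sumF (P i))
      ≈⟨ +-cong (+-congˡ (trans (sumF-cong (λ j → *-assoc (- S) (r j) (y j))) (sym (*-distribˡ-sumF (- S) (λ j → r j * y j)))))
                (sumF-distrib-+ (λ i → (y i * c′ i) * (- S)) (λ i → sumF (P i))) ⟩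
    (((- S) * a) * (- S) + (- S) * Σry) + (Σyc + ΣP)
      ≈⟨ +-congˡ (+-congʳ (sym (*-distribʳ-sumF (- S) (λ i → y i * c′ i)))) ⟩
    (((- S) * a) * (- S) + (- S) * Σry) + (Σyc′ * (- S) + ΣP)
      ≈⟨ solve 5 (λ S a Q C P → (((:- S) :* a) :* (:- S) :+ (:- S) :* Q) :+ (C :* (:- S) :+ P)
                        := P :+ ((:- C) :* S :+ ((:- Q) :* S :+ a :* (S :* S)))) refl S a Σry Σyc′ ΣP ⟩
    ΣP + ((- Σyc′) * S + ((- Σry) * S + a * (S * S)))
      ≈⟨ sym compressed ⟩
    quadForm (compress A) y ∎
    where
    S = sumF y
    a = A zero zero
    r c′ : Fin k → Carrier
    r j = A zero (suc j)
    c′ i = A (suc i) zero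
    P : Fin k → Fin k → Carrier
    P i j = (y i * A (suc i) (suc j)) * y j
    Σry = sumF (λ j → r j * y j)
    Σyc = sumF (λ i → (y i * c′ i) * (- S))
    Σyc′ = sumF (λ i → y i * c′ i)
    ΣP = sumF (λ i → sumF (P i))
    row : ∀ i → sumF (λ j → (y i * compress A i j) * y j) ≈ sumF (P i) + ((y i * c′ i) * (- S) + (y i * (- Σry) + a * (y i * S)))
    row i = begin
      sumF (λ j → (y i * compress A i j) * y j)
        ≈⟨ sumF-cong (λ j → solve 6 (λ yi A′ c rj a yj → (yi :* (((A′ :- c) :- rj) :+ a)) :* yj
                                      := (yi :* A′) :* yj :+ ((yi :* c) :* (:- yj) :+ (yi :* (:- (rj :* yj)) :+ a :* (yi :* yj))))
                                    refl (y i) (A (suc i) (suc j)) (c′ i) (r j) a (y j)) ⟩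
      sumF (λ j → P i j + ((y i * c′ i) * (- y j) + (y i * (- (r j * y j)) + a * (y i * y j))))
        ≈⟨ trans (sumF-distrib-+ (P i) _) (+-congˡ (trans (sumF-distrib-+ (λ j → (y i * c′ i) * (- y j)) _)
                                                          (+-congˡ (sumF-distrib-+ (λ j → y i * (- (r j * y j))) _)))) ⟩
      sumF (P i) + (sumF (λ j → (y i * c′ i) * (- y j)) + (sumF (λ j → y i * (- (r j * y j))) + sumF (λ j → a * (y i * y j))))
        ≈⟨ +-congˡ (+-cong (trans (sym (*-distribˡ-sumF (y i * c′ i) (λ j → - y j))) (*-congˡ (sumF-neg y)))
                           (+-cong (trans (sym (*-distribˡ-sumF (y i) (λ j → - (r j * y j)))) (*-congˡ (sumF-neg (λ j → r j * y j))))
                                   (trans (sym (*-distribˡ-sumF a (λ j → y i * y j))) (*-congˡ (sym (*-distribˡ-sumF (y i) y)))))) ⟩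
      sumF (P i) + ((y i * c′ i) * (- S) + (y i * (- Σry) + a * (y i * S))) ∎
    compressed : quadForm (compress A) y ≈ ΣP + ((- Σyc′) * S + ((- Σry) * S + a * (S * S)))
    compressed = begin
      quadForm (compress A) y
        ≈⟨ sumF-cong row ⟩
      sumF (λ i → sumF (P i) + ((y i * c′ i) * (- S) + (y i * (- Σry) + a * (y i * S))))
        ≈⟨ trans (sumF-distrib-+ (λ i → sumF (P i)) _) (+-congˡ (trans (sumF-distrib-+ (λ i → (y i * c′ i) * (- S)) _)
                                                                        (+-congˡ (sumF-distrib-+ (λ i → y i * (- Σry)) _)))) ⟩
      ΣP + (Σyc + (sumF (λ i → y i * (- Σry)) + sumF (λ i → a * (y i * S))))
        ≈⟨ +-congˡ (+-cong (trans (sym (*-distribʳ-sumF (- S) (λ i → y i * c′ i)))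
                                  (solve 2 (λ C S → C :* (:- S) := (:- C) :* S) refl Σyc′ S))
                           (+-cong (trans (sym (*-distribʳ-sumF (- Σry) y)) (*-comm S (- Σry)))
                                   (trans (sym (*-distribˡ-sumF a (λ i → y i * S))) (*-congˡ (sym (*-distribʳ-sumF S y)))))) ⟩
      ΣP + ((- Σyc′) * S + ((- Σry) * S + a * (S * S))) ∎

  compress-anisotropic : ∀ {A : Matrix (suc k)} → ConditionallyNegativeDefinite A → Anisotropic (compress A)
  compress-anisotropic {A = A} cnd y i yᵢ≉0 q≈0 = ConditionallyNegativeDefinite.definite cnd
    (liftZeroSum y) (sumF-liftZeroSum y) (suc i) yᵢ≉0 (trans (quadForm-liftZeroSum A y) q≈0)

  -- Solve the compressed system for u₁ … uₖ and put u₀ = 1 - Σ uᵢ.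
  balancingVector : ∀ k (A : Matrix (suc k)) → ConditionallyNegativeDefinite A →
                    Σ (Fin (suc k) → Carrier) (λ u → (sumF u ≈ 1#) × (∀ i → (A *ᵥ u) i ≈ (A *ᵥ u) zero))
  balancingVector zero    A cnd = (λ _ → 1#) , +-identityʳ 1# , λ { zero → refl }
  balancingVector (suc k) A cnd = u , sumF-u , balanced
    where
    B : Matrix (suc k)
    B = compress A
    detB≉0 : ¬ (det (suc k) B ≈ 0#)
    detB≉0 = det-anisotropic 0≉1 (suc k) B (compress-anisotropic cnd)
    δ : Carrier
    δ = proj₁ (inverse (det (suc k) B) detB≉0)
    b : Fin (suc k) → Carrier
    b i = - (A (suc i) zero - A zero zero)
    solution = solve-linear k B δ (trans (*-comm _ _) (proj₂ (inverse (det (suc k) B) detB≉0))) b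
    y : Fin (suc k) → Carrier
    y = proj₁ solution
    S = sumF y
    u : Fin (suc (suc k)) → Carrier
    u zero    = 1# - S
    u (suc i) = y i
    sumF-u : sumF u ≈ 1#
    sumF-u = solve 2 (λ o S → (o :- S) :+ S := o) refl 1# S
    a = A zero zero
    Q = sumF (λ j → A zero (suc j) * y j)
    balanced : ∀ i → (A *ᵥ u) i ≈ (A *ᵥ u) zero
    balanced zero    = refl
    balanced (suc i) = begin
      c′ * (1# - S) + P
        ≈⟨ solve 5 (λ a c′ S P Q → c′ :* (con (ℤ.+ 1) :- S) :+ P
                       := (a :* (con (ℤ.+ 1) :- S) :+ Q) :+ (((P :- Q) :+ (a :- c′) :* S) :+ (c′ :- a)))
                   refl a c′ S P Q ⟩
      (a * (1# - S) + Q) + (((P - Q) + (a - c′) * S) + (c′ - a))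
        ≈⟨ +-congˡ (+-congʳ By≈b) ⟩
      (a * (1# - S) + Q) + (- (c′ - a) + (c′ - a))
        ≈⟨ trans (+-congˡ (-‿inverseˡ _)) (+-identityʳ _) ⟩
      a * (1# - S) + Q ∎
      where
      c′ = A (suc i) zero
      P = sumF (λ j → A (suc i) (suc j) * y j)
      By≈b : (P - Q) + (a - c′) * S ≈ - (c′ - a)
      By≈b = begin
        (P - Q) + (a - c′) * S
          ≈⟨ +-cong (+-congˡ (sym (sumF-neg (λ j → A zero (suc j) * y j)))) (*-distribˡ-sumF (a - c′) y) ⟩
        (P + sumF (λ j → - (A zero (suc j) * y j))) + sumF (λ j → (a - c′) * y j)
          ≈⟨ +-congʳ (sym (sumF-distrib-+ (λ j → A (suc i) (suc j) * y j) (λ j → - (A zero (suc j) * y j)))) ⟩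
        sumF (λ j → A (suc i) (suc j) * y j - A zero (suc j) * y j) + sumF (λ j → (a - c′) * y j)
          ≈⟨ sym (sumF-distrib-+ (λ j → A (suc i) (suc j) * y j - A zero (suc j) * y j) (λ j → (a - c′) * y j)) ⟩
        sumF (λ j → (A (suc i) (suc j) * y j - A zero (suc j) * y j) + (a - c′) * y j)
          ≈⟨ sumF-cong (λ j → solve 5 (λ A′ r a c yj → (A′ :* yj :- r :* yj) :+ (a :- c) :* yj := (((A′ :- c) :- r) :+ a) :* yj)
                                      refl (A (suc i) (suc j)) (A zero (suc j)) a c′ (y j)) ⟩
        (B *ᵥ y) i
          ≈⟨ proj₂ solution i ⟩
        - (c′ - a) ∎

  module Maximiser {k} (A : Matrix (suc k)) (sym-A : Symmetric A) (cnd : ConditionallyNegativeDefinite A) where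
    open ConditionallyNegativeDefinite cnd

    u : Fin (suc k) → Carrier
    u = proj₁ (balancingVector k A cnd)

    sumF-u : sumF u ≈ 1#
    sumF-u = proj₁ (proj₂ (balancingVector k A cnd))

    r : Carrier
    r = (A *ᵥ u) zero

    A*u≈r : ∀ i → (A *ᵥ u) i ≈ r
    A*u≈r = proj₂ (proj₂ (balancingVector k A cnd))

    bilinear-u : ∀ x → bilinear A x u ≈ r * sumF x
    bilinear-u x = begin
      bilinear A x u                ≈⟨ bilinear≈dot-*ᵥ A x u ⟩
      sumF (λ i → x i * (A *ᵥ u) i) ≈⟨ sumF-cong (λ i → trans (*-congˡ (A*u≈r i)) (*-comm (x i) r)) ⟩
      sumF (λ i → r * x i)          ≈⟨ *-distribˡ-sumF r x ⟨
      r * sumF x                    ∎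

    quadForm-u : quadForm A u ≈ r
    quadForm-u = trans (bilinear-u u) (trans (*-congˡ sumF-u) (*-identityʳ r))

    project : (Fin (suc k) → Carrier) → Fin (suc k) → Carrier
    project x i = x i - sumF x * u i

    sumF-project : ∀ x → sumF (project x) ≈ 0#
    sumF-project x = begin
      sumF (λ i → x i - sumF x * u i)          ≈⟨ sumF-distrib-+ x (λ i → - (sumF x * u i)) ⟩
      sumF x + sumF (λ i → - (sumF x * u i))   ≈⟨ +-congˡ (sumF-neg (λ i → sumF x * u i)) ⟩
      sumF x - sumF (λ i → sumF x * u i)       ≈⟨ +-congˡ (-‿cong (*-distribˡ-sumF (sumF x) u)) ⟨
      sumF x - sumF x * sumF u                 ≈⟨ +-congˡ (-‿cong (trans (*-congˡ sumF-u) (*-identityʳ _))) ⟩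
      sumF x - sumF x                          ≈⟨ -‿inverseʳ (sumF x) ⟩
      0#                                       ∎

    project-decomposition : ∀ x i → x i ≈ project x i + sumF x * u i
    project-decomposition x i = solve 3 (λ a t b → a := (a :- t :* b) :+ t :* b) refl (x i) (sumF x) (u i)

    -- Since the form pairs every zero-sum vector with u to 0, it splits orthogonally.
    quadForm-decompose : ∀ x → quadForm A x ≈ (sumF x * sumF x) * r + quadForm A (project x)
    quadForm-decompose x = begin
      quadForm A x
        ≈⟨ sumF-cong (λ i → sumF-cong λ j →
             *-cong (*-congʳ {A i j} (project-decomposition x i)) (project-decomposition x j)) ⟩
      quadForm A (λ i → y i + t * u i)
        ≈⟨ quadForm-+-* sym-A y t u ⟩
      quadForm A y + ((t + t) * bilinear A y u + (t * t) * quadForm A u)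
        ≈⟨ +-congˡ (+-cong (*-congˡ (trans (bilinear-u y) (trans (*-congˡ (sumF-project x)) (zeroʳ r)))) (*-congˡ quadForm-u)) ⟩
      quadForm A y + ((t + t) * 0# + (t * t) * r)
        ≈⟨ solve 3 (λ q t r → q :+ ((t :+ t) :* con (ℤ.+ 0) :+ (t :* t) :* r) := (t :* t) :* r :+ q) refl _ t r ⟩
      (t * t) * r + quadForm A y ∎
      where
      t = sumF x
      y = project x

    quadForm≤r : ∀ v → sumF v ≈ 1# → quadForm A v ≤ r
    quadForm≤r v sumF-v≈1 = ≲-respˡ-≈ (sym (trans (quadForm-decompose v) (+-comm _ _)))
                              (≲-respʳ-≈ t²r+0≈r (+-mono-≤ ((sumF v * sumF v) * r) (nonpositive (project v) (sumF-project v))))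
      where
      t²r+0≈r : 0# + (sumF v * sumF v) * r ≈ r
      t²r+0≈r = trans (+-identityˡ _) (trans (*-congʳ (trans (*-cong sumF-v≈1 sumF-v≈1) (*-identityˡ 1#))) (*-identityˡ r))

    det≈r*cof : det (suc k) A ≈ r * cof k A
    det≈r*cof = begin
      det (suc k) A                              ≈⟨ solve 3 (λ d r C → d := (d :+ (:- r) :* C) :+ r :* C) refl _ r _ ⟩
      (det (suc k) A + (- r) * cof k A) + r * cof k A  ≈⟨ +-congʳ (sym (det-addConstant k A (- r))) ⟩
      det (suc k) (addConstant A (- r)) + r * cof k A  ≈⟨ +-congʳ det-A-rJ≈0 ⟩
      0# + r * cof k A                           ≈⟨ +-identityˡ _ ⟩
      r * cof k A                                ∎
      where
      u-leftKernel : ∀ c → sumF (λ i → u i * addConstant A (- r) i c) ≈ 0#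
      u-leftKernel c = begin
        sumF (λ i → u i * (A i c - r))
          ≈⟨ sumF-cong (λ i → trans (distribˡ (u i) (A i c) (- r)) (+-cong (trans (*-comm _ _) (*-congʳ (sym-A i c))) (*-comm _ _))) ⟩
        sumF (λ i → A c i * u i + (- r) * u i)
          ≈⟨ sumF-distrib-+ (λ i → A c i * u i) (λ i → (- r) * u i) ⟩
        (A *ᵥ u) c + sumF (λ i → (- r) * u i)
          ≈⟨ +-cong (A*u≈r c) (trans (sym (*-distribˡ-sumF (- r) u)) (trans (*-congˡ sumF-u) (*-identityʳ _))) ⟩
        r - r
          ≈⟨ -‿inverseʳ r ⟩
        0# ∎
      det-A-rJ≈0 : det (suc k) (addConstant A (- r)) ≈ 0#
      det-A-rJ≈0 = begin
        det (suc k) (addConstant A (- r))                        ≈⟨ *-identityʳ _ ⟨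
        det (suc k) (addConstant A (- r)) * 1#                   ≈⟨ *-congˡ sumF-u ⟨
        det (suc k) (addConstant A (- r)) * sumF u               ≈⟨ trans (*-comm _ _) (*-distribʳ-sumF _ u) ⟩
        sumF (λ i → u i * det (suc k) (addConstant A (- r)))
          ≈⟨ sumF-zero (λ i → u i * det (suc k) (addConstant A (- r))) (det-leftKernel k (addConstant A (- r)) u u-leftKernel) ⟩
        0#                                                       ∎

    -- If cof A ≈ 0 then det (A - (r + 1) J) ≈ 0, but A - (r + 1) J is anisotropic:
    -- its form is q(project x) - (Σ x)², a sum of two nonpositive terms.
    cof≉0 : ¬ (cof k A ≈ 0#)
    cof≉0 cof≈0 = det-anisotropic 0≉1 (suc k) A′ A′-anisotropic (begin
      det (suc k) A′                                 ≈⟨ det-addConstant k A (- (r + 1#)) ⟩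
      det (suc k) A + (- (r + 1#)) * cof k A         ≈⟨ +-cong det≈r*cof (*-congˡ cof≈0) ⟩
      r * cof k A + (- (r + 1#)) * 0#                ≈⟨ +-cong (trans (*-congˡ cof≈0) (zeroʳ r)) (zeroʳ _) ⟩
      0# + 0#                                        ≈⟨ +-identityˡ 0# ⟩
      0#                                             ∎)
      where
      A′ : Matrix (suc k)
      A′ = addConstant A (- (r + 1#))
      A′-anisotropic : Anisotropic A′
      A′-anisotropic x i xᵢ≉0 q′≈0 = x*x≈0⇒¬¬x≈0 t t²≈0 λ t≈0 →
          definite y (sumF-project x) i (yᵢ≉0 t≈0) qy≈0
        where
        t = sumF x
        y = project x
        qy≈t² : quadForm A y ≈ t * t
        qy≈t² = begin
          quadForm A y
            ≈⟨ solve 3 (λ q t r → q := (((t :* t) :* r :+ q) :+ (:- (r :+ con (ℤ.+ 1))) :* (t :* t)) :+ t :* t) refl _ t r ⟩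
          (((t * t) * r + quadForm A y) + (- (r + 1#)) * (t * t)) + t * t
            ≈⟨ +-congʳ (trans (+-congʳ (sym (quadForm-decompose x))) (trans (sym (quadForm-addConstant A (- (r + 1#)) x)) q′≈0)) ⟩
          0# + t * t
            ≈⟨ +-identityˡ _ ⟩
          t * t ∎
        t²≈0 : t * t ≈ 0#
        t²≈0 = antisym (≲-respˡ-≈ qy≈t² (nonpositive y (sumF-project x))) (x*x≥0 t)
        qy≈0 : quadForm A y ≈ 0#
        qy≈0 = trans qy≈t² t²≈0
        yᵢ≉0 : t ≈ 0# → ¬ (y i ≈ 0#)
        yᵢ≉0 t≈0 yᵢ≈0 = xᵢ≉0 (begin
          x i              ≈⟨ project-decomposition x i ⟩
          y i + t * u i    ≈⟨ +-cong yᵢ≈0 (trans (*-congʳ t≈0) (zeroˡ _)) ⟩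
          0# + 0#          ≈⟨ +-identityˡ 0# ⟩
          0#               ∎)

module Walks {n m : ℕ} (G : Graph n m) where
  open Graph G
  open GraphDefs G

  Loopless : Set
  Loopless = ∀ e → proj₁ (ends e) ≢ proj₂ (ends e)

  joins-sym : ∀ {e a b} → Joins e a b → Joins e b a
  joins-sym (inj₁ eq) = inj₂ eq
  joins-sym (inj₂ eq) = inj₁ eq

  joins-loopless : Loopless → ∀ {e a b} → Joins e a b → a ≢ b
  joins-loopless loopless {e} (inj₁ eq) ≡.refl = loopless e (≡.trans (≡.cong proj₁ eq) (≡.sym (≡.cong proj₂ eq)))
  joins-loopless loopless {e} (inj₂ eq) ≡.refl = loopless e (≡.trans (≡.cong proj₁ eq) (≡.sym (≡.cong proj₂ eq)))

  joins-unique : ∀ {e a b a′ b′} → Joins e a b → Joins e a′ b′ → (a ≡ a′ × b ≡ b′) ⊎ (a ≡ b′ × b ≡ a′)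
  joins-unique (inj₁ p) (inj₁ q) = inj₁ (≡.cong proj₁ (≡.trans (≡.sym p) q) , ≡.cong proj₂ (≡.trans (≡.sym p) q))
  joins-unique (inj₁ p) (inj₂ q) = inj₂ (≡.cong proj₁ (≡.trans (≡.sym p) q) , ≡.cong proj₂ (≡.trans (≡.sym p) q))
  joins-unique (inj₂ p) (inj₁ q) = inj₂ (≡.cong proj₂ (≡.trans (≡.sym p) q) , ≡.cong proj₁ (≡.trans (≡.sym p) q))
  joins-unique (inj₂ p) (inj₂ q) = inj₁ (≡.cong proj₂ (≡.trans (≡.sym p) q) , ≡.cong proj₁ (≡.trans (≡.sym p) q))

  infixr 5 _++ʷ_
  _++ʷ_ : ∀ {u v w} → Walk u v → Walk v w → Walk u w
  []           ++ʷ q = q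
  step e j p   ++ʷ q = step e j (p ++ʷ q)

  edges-++ʷ : ∀ {u v w} (p : Walk u v) (q : Walk v w) → edges (p ++ʷ q) ≡ edges p ++ edges q
  edges-++ʷ []           q = ≡.refl
  edges-++ʷ (step e j p) q = ≡.cong (e ∷_) (edges-++ʷ p q)

  start∈vertices : ∀ {u v} (p : Walk u v) → u ∈ vertices p
  start∈vertices []           = here ≡.refl
  start∈vertices (step e j p) = here ≡.refl

  end∈vertices : ∀ {u v} (p : Walk u v) → v ∈ vertices p
  end∈vertices []           = here ≡.refl
  end∈vertices (step e j p) = there (end∈vertices p)

  ∈-vertices-++ʷˡ : ∀ {u v w x} (p : Walk u v) (q : Walk v w) → x ∈ vertices p → x ∈ vertices (p ++ʷ q)
  ∈-vertices-++ʷˡ []           q (here ≡.refl) = start∈vertices q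
  ∈-vertices-++ʷˡ (step e j p) q (here eq)     = here eq
  ∈-vertices-++ʷˡ (step e j p) q (there x∈p)   = there (∈-vertices-++ʷˡ p q x∈p)

  unique-++ʷ : ∀ {u v w} (p : Walk u v) (q : Walk v w) → Unique (vertices (p ++ʷ q)) →
               Unique (vertices p) × Unique (vertices q)
  unique-++ʷ []           q uniq = (All.[] AllPairs.∷ AllPairs.[]) , uniq
  unique-++ʷ (step e j p) q (u∉ AllPairs.∷ uniq) =
    (All.tabulate (All.lookup u∉ ∘ ∈-vertices-++ʷˡ p q) AllPairs.∷ proj₁ (unique-++ʷ p q uniq)) , proj₂ (unique-++ʷ p q uniq)

  splitAt-vertex : ∀ {u v x} (p : Walk u v) → x ∈ vertices p →
                   Σ (Walk u x) (λ p₁ → Σ (Walk x v) (λ p₂ → p ≡ p₁ ++ʷ p₂))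
  splitAt-vertex []           (here ≡.refl) = [] , [] , ≡.refl
  splitAt-vertex (step e j p) (here ≡.refl) = [] , step e j p , ≡.refl
  splitAt-vertex (step e j p) (there x∈p) with splitAt-vertex p x∈p
  ... | p₁ , p₂ , eq = step e j p₁ , p₂ , ≡.cong (step e j) eq

  record SplitAtEdge {u v} (e : Fin m) (p : Walk u v) : Set where
    field
      {a b}  : Fin n
      joins  : Joins e a b
      before : Walk u a
      after  : Walk b v
      split  : p ≡ before ++ʷ step e joins after

  splitAt-edge : ∀ {u v e} (p : Walk u v) → e ∈ edges p → SplitAtEdge e p
  splitAt-edge (step f j p) (here ≡.refl) = record { joins = j ; before = [] ; after = p ; split = ≡.refl }
  splitAt-edge (step f j p) (there e∈p)   = record
    { joins = joins ; before = step f j before ; after = after ; split = ≡.cong (step f j) split }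
    where
    open SplitAtEdge (splitAt-edge p e∈p)

  endpoint∈vertices : ∀ {u v e x y} (p : Walk u v) → e ∈ edges p → Joins e x y → x ∈ vertices p
  endpoint∈vertices (step f j p) (here ≡.refl) jx with joins-unique jx j
  ... | inj₁ (≡.refl , _) = here ≡.refl
  ... | inj₂ (≡.refl , _) = there (start∈vertices p)
  endpoint∈vertices (step f j p) (there e∈p) jx = there (endpoint∈vertices p e∈p jx)

  parity : List (Fin m) → Fin m → Bool
  parity []       e = false
  parity (f ∷ fs) e = does (f ≟F e) xor parity fs e

  parity-++ : ∀ xs ys e → parity (xs ++ ys) e ≡ parity xs e xor parity ys e
  parity-++ []       ys e = ≡.refl
  parity-++ (f ∷ xs) ys e = ≡.trans (≡.cong (does (f ≟F e) xor_) (parity-++ xs ys e))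
                                    (≡.sym (xor-assoc (does (f ≟F e)) _ _))

  parity⇒∈ : ∀ xs e → parity xs e ≡ true → e ∈ xs
  parity⇒∈ (f ∷ xs) e odd with f ≟F e
  ... | yes ≡.refl = here ≡.refl
  ... | no _       = there (parity⇒∈ xs e odd)

  ∉⇒parity-false : ∀ xs e → ¬ (e ∈ xs) → parity xs e ≡ false
  ∉⇒parity-false xs e e∉xs with parity xs e in eq
  ... | true  = ⊥-elim (e∉xs (parity⇒∈ xs e eq))
  ... | false = ≡.refl

  does-refl : ∀ (e : Fin m) → does (e ≟F e) ≡ true
  does-refl e with e ≟F e
  ... | yes _   = ≡.refl
  ... | no e≢e  = ⊥-elim (e≢e ≡.refl)

  xor-cancelˡ : ∀ a b → a xor (a xor b) ≡ b
  xor-cancelˡ a b = ≡.trans (≡.sym (xor-assoc a a b)) (≡.cong (_xor b) (xor-same a))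

module Trees {n m : ℕ} (G : Graph n m) (tree : GraphDefs.IsTree G) where
  open Graph G
  open GraphDefs G
  open Walks G

  private
    loopless : Loopless
    loopless = proj₁ tree
    path : ∀ u v → Path u v
    path = proj₁ (proj₂ tree)
    path-unique : ∀ u v (p q : Path u v) → edges (proj₁ p) ≡ edges (proj₁ q)
    path-unique = proj₂ (proj₂ tree)

  closedPath-edges : ∀ {v} (p : Path v v) → edges (proj₁ p) ≡ []
  closedPath-edges ([]         , _)                  = ≡.refl
  closedPath-edges (step e j p , v∉p AllPairs.∷ _) = ⊥-elim (All.lookup v∉p (end∈vertices p) ≡.refl)

  -- If the vertex u is already on the reduced rest of the walk, the detour back to u is a path
  -- with the same ends as the edge f, hence (by uniqueness of paths) it is just f.
  walk⇒path : ∀ {u v} (W : Walk u v) → Σ (Path u v) (λ p → ∀ e → parity (edges W) e ≡ parity (edges (proj₁ p)) e)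
  walk⇒path [] = ([] , (All.[] AllPairs.∷ AllPairs.[])) , λ e → ≡.refl
  walk⇒path {u} (step f j W) with walk⇒path W
  ... | (p , uniq) , same-parity with DecMembership._∈?_ _≟F_ u (vertices p)
  ...   | no u∉p  = (step f j p , (u∉vertices AllPairs.∷ uniq)) , λ e → ≡.cong (does (f ≟F e) xor_) (same-parity e)
    where
    u∉vertices = All.tabulate (λ x∈p u≡x → u∉p (≡.subst (_∈ vertices p) (≡.sym u≡x) x∈p))
  ...   | yes u∈p with splitAt-vertex p u∈p
  ...     | p₁ , p₂ , p≡p₁p₂ = (p₂ , proj₂ uniques) , parity-detour
    where
    open ≡.≡-Reasoning
    uniques = unique-++ʷ p₁ p₂ (≡.subst (Unique ∘ vertices) p≡p₁p₂ uniq)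
    edge-f : Path _ u
    edge-f = step f (joins-sym j) [] , ((joins-loopless loopless j ∘ ≡.sym) All.∷ All.[]) AllPairs.∷ (All.[] AllPairs.∷ AllPairs.[])
    p₁≡f : edges p₁ ≡ f ∷ []
    p₁≡f = path-unique _ _ (p₁ , proj₁ uniques) edge-f
    parity-detour : ∀ e → does (f ≟F e) xor parity (edges W) e ≡ parity (edges p₂) e
    parity-detour e = begin
      d xor parity (edges W) e
        ≡⟨ ≡.cong (d xor_) (same-parity e) ⟩
      d xor parity (edges p) e
        ≡⟨ ≡.cong (λ es → d xor parity es e) (≡.trans (≡.cong edges p≡p₁p₂) (edges-++ʷ p₁ p₂)) ⟩
      d xor parity (edges p₁ ++ edges p₂) e
        ≡⟨ ≡.cong (d xor_) (parity-++ (edges p₁) (edges p₂) e) ⟩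
      d xor (parity (edges p₁) e xor parity (edges p₂) e)
        ≡⟨ ≡.cong (λ es → d xor (parity es e xor parity (edges p₂) e)) p₁≡f ⟩
      d xor ((d xor false) xor parity (edges p₂) e)
        ≡⟨ ≡.cong (λ b → d xor (b xor parity (edges p₂) e)) (xor-identityʳ d) ⟩
      d xor (d xor parity (edges p₂) e)
        ≡⟨ xor-cancelˡ d _ ⟩
      parity (edges p₂) e ∎
      where
      d = does (f ≟F e)

  module Rooted (ρ : Fin n) where
    toRoot : ∀ v → Path v ρ
    toRoot v = path v ρ

    onRootPath : Fin n → Fin m → Bool
    onRootPath v = parity (edges (proj₁ (toRoot v)))

    depth : Fin n → ℕ
    depth v = List.length (edges (proj₁ (toRoot v)))

    private
      open ≡.≡-Reasoning

      fromRoot : ∀ v → Walk ρ v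
      fromRoot v = proj₁ (path ρ v)

      viaRoot : ∀ u v → Walk u v
      viaRoot u v = proj₁ (toRoot u) ++ʷ fromRoot v

      parity-viaRoot : ∀ u v e → parity (edges (viaRoot u v)) e ≡ onRootPath u e xor parity (edges (fromRoot v)) e
      parity-viaRoot u v e = ≡.trans (≡.cong (λ es → parity es e) (edges-++ʷ (proj₁ (toRoot u)) (fromRoot v)))
                                     (parity-++ (edges (proj₁ (toRoot u))) (edges (fromRoot v)) e)

      parity-fromRoot : ∀ v e → parity (edges (fromRoot v)) e ≡ onRootPath v e
      parity-fromRoot v e = begin
        parity (edges (fromRoot v)) e                       ≡⟨ xor-cancelˡ σ _ ⟨
        σ xor (σ xor parity (edges (fromRoot v)) e)         ≡⟨ ≡.cong (σ xor_) closed ⟩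
        σ xor false                                         ≡⟨ xor-identityʳ σ ⟩
        σ                                                   ∎
        where
        σ = onRootPath v e
        closed : σ xor parity (edges (fromRoot v)) e ≡ false
        closed = begin
          σ xor parity (edges (fromRoot v)) e                          ≡⟨ parity-viaRoot v v e ⟨
          parity (edges (viaRoot v v)) e                               ≡⟨ proj₂ (walk⇒path (viaRoot v v)) e ⟩
          parity (edges (proj₁ (proj₁ (walk⇒path (viaRoot v v))))) e   ≡⟨ ≡.cong (λ es → parity es e)
                                                                            (closedPath-edges (proj₁ (walk⇒path (viaRoot v v)))) ⟩
          false                                                        ∎

    path-parity : ∀ u v → Σ (Path u v) (λ p → ∀ e → parity (edges (proj₁ p)) e ≡ onRootPath u e xor onRootPath v e)
    path-parity u v = proj₁ (walk⇒path (viaRoot u v)) , λ e → begin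
      parity (edges (proj₁ (proj₁ (walk⇒path (viaRoot u v))))) e  ≡⟨ proj₂ (walk⇒path (viaRoot u v)) e ⟨
      parity (edges (viaRoot u v)) e                              ≡⟨ parity-viaRoot u v e ⟩
      onRootPath u e xor parity (edges (fromRoot v)) e            ≡⟨ ≡.cong (onRootPath u e xor_) (parity-fromRoot v e) ⟩
      onRootPath u e xor onRootPath v e                           ∎

    depth-root : depth ρ ≡ 0
    depth-root = ≡.cong List.length (closedPath-edges (toRoot ρ))

    depth-nonRoot : ∀ w → w ≢ ρ → 0 ℕ.< depth w
    depth-nonRoot w w≢ρ with proj₁ (toRoot w)
    ... | []         = ⊥-elim (w≢ρ ≡.refl)
    ... | step e j q = ℕ.s≤s ℕ.z≤n

    -- The first edge on the path from v to the root.
    record ParentEdge (v : Fin n) : Set where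
      field
        edge      : Fin m
        onPath    : onRootPath v edge ≡ true
        onlyBelow : ∀ w → onRootPath w edge ≡ true → w ≡ v ⊎ depth v ℕ.< depth w

    -- If e = {v, p} starts the root path of v, a root path through e meets v before p (else e
    -- would occur twice on the root path of v), and from v on it has the length of that path.
    through-first-edge : ∀ {v p e} (j₀ : Joins e v p) (q : Walk p ρ) →
      step e j₀ q ≡ proj₁ (toRoot v) → ∀ w → SplitAtEdge e (proj₁ (toRoot w)) → w ≡ v ⊎ depth v ℕ.< depth w
    through-first-edge {v} {p} {e} j₀ q q≡ w s = orientation (joins-unique joins j₀)
      where
      open SplitAtEdge s
      uniques = unique-++ʷ before (step e joins after) (≡.subst (Unique ∘ vertices) split (proj₂ (toRoot w)))
      depth-w : depth w ≡ List.length (edges before) ℕ.+ suc (List.length (edges after))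
      depth-w = ≡.trans (≡.cong (List.length ∘ edges) split)
                  (≡.trans (≡.cong List.length (edges-++ʷ before (step e joins after))) (length-++ (edges before)))
      below : ∀ {x} → x ≡ v → (A : Walk w x) (B : Walk x ρ) → Unique (vertices B) →
              List.length (edges B) ≡ suc (List.length (edges after)) →
              List.length (edges A) ≡ List.length (edges before) → w ≡ v ⊎ depth v ℕ.< depth w
      below ≡.refl []            B uniqB lenB lenA = inj₁ ≡.refl
      below ≡.refl (step f _ A′) B uniqB lenB lenA = inj₂ (≡.subst (depth v ℕ.<_) (≡.sym depth-w)
        (≡.subst₂ (λ d l → d ℕ.< l ℕ.+ suc (List.length (edges after)))
                  (≡.sym (≡.trans (≡.cong List.length (path-unique v ρ (toRoot v) (B , uniqB))) lenB)) lenA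
                  (ℕ.s≤s (ℕₚ.m≤n+m (suc (List.length (edges after))) (List.length (edges A′))))))
      e-twice : b ≡ v → (B : Walk b ρ) → Unique (a ∷ vertices B) → ⊥
      e-twice ≡.refl B (a∉B AllPairs.∷ uniqB) = All.lookup a∉B (endpoint∈vertices B e∈B joins) ≡.refl
        where
        e∈B : e ∈ edges B
        e∈B = ≡.subst (e ∈_) (≡.trans (≡.cong edges q≡) (path-unique v ρ (toRoot v) (B , uniqB))) (here ≡.refl)
      orientation : (a ≡ v × b ≡ p) ⊎ (a ≡ p × b ≡ v) → w ≡ v ⊎ depth v ℕ.< depth w
      orientation (inj₁ (a≡v , _)) = below a≡v before (step e joins after) (proj₂ uniques) ≡.refl ≡.refl
      orientation (inj₂ (_ , b≡v)) = ⊥-elim (e-twice b≡v after (proj₂ uniques))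

    parentEdge : ∀ v → v ≢ ρ → ParentEdge v
    parentEdge v v≢ρ = fromPath (proj₁ (toRoot v)) (proj₂ (toRoot v)) ≡.refl
      where
      fromPath : (q : Walk v ρ) → Unique (vertices q) → q ≡ proj₁ (toRoot v) → ParentEdge v
      fromPath []              _                   _  = ⊥-elim (v≢ρ ≡.refl)
      fromPath (step e j₀ q) (v∉q AllPairs.∷ _) q≡ = record
        { edge      = e
        ; onPath    = ≡.trans (≡.cong (λ q′ → parity (edges q′) e) (≡.sym q≡))
                              (≡.cong₂ _xor_ (does-refl e) (∉⇒parity-false (edges q) e e∉q))
        ; onlyBelow = λ w on-w → through-first-edge j₀ q q≡ w (splitAt-edge (proj₁ (toRoot w)) (parity⇒∈ _ e on-w))
        }
        where
        e∉q : ¬ (e ∈ edges q)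
        e∉q e∈q = All.lookup v∉q (endpoint∈vertices q e∈q j₀) ≡.refl

module TreeDistanceMatrix {c ℓ₁ ℓ₂} (F : OrderedField c ℓ₁ ℓ₂) {n m : ℕ} (G : Graph n m)
  (tree : GraphDefs.IsTree G) (α : Fin m → OrderedField.Carrier F)
  (α>0 : ∀ e → OrderedField._<_ F (OrderedField.0# F) (α e)) (D : Fin n → Fin n → OrderedField.Carrier F)
  (isDist : GraphDefs.IsDistanceMatrix G (OrderedField.commutativeRing F) α D) (ρ : Fin n) where
  open OrderedField F hiding (zero)
  open MatrixDefs commutativeRing
  open FiniteSums commutativeRing
  open Matrices commutativeRing
  open OrderedFieldProperties F
  open ConditionallyNegativeDefiniteMatrices F
  open IntegerCoefficientSolver commutativeRing using (Polynomial; solve; _:=_; _:+_; _:*_; :-_; con)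
  open GraphDefs G
  open Walks G
  open Trees G tree
  open Rooted ρ
  open import Relation.Binary.Reasoning.Setoid setoid

  private
    open Algebra.Properties.CommutativeMonoid.Sum ℕₚ.+-0-commutativeMonoid using (sum-remove) renaming (sum to sumℕ)

    ≤-sumℕ : ∀ {k} (f : Fin k → ℕ) i → f i ℕ.≤ sumℕ f
    ≤-sumℕ {suc k} f i = ℕₚ.≤-trans (ℕₚ.m≤m+n (f i) _) (ℕₚ.≤-reflexive (≡.sym (sum-remove f)))

  private
    𝟘 𝟙 : Polynomial 0
    𝟘 = con (ℤ.+ 0)
    𝟙 = con (ℤ.+ 1)

  indicator : Bool → Carrier
  indicator true  = 1#
  indicator false = 0#

  two : Carrier
  two = 1# + 1#

  indicator-xor : ∀ a b → indicator (a xor b) ≈ (indicator a + indicator b) + (- two) * (indicator a * indicator b)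
  indicator-xor true  true  = solve 0 (𝟘 := (𝟙 :+ 𝟙) :+ (:- (𝟙 :+ 𝟙)) :* (𝟙 :* 𝟙)) refl
  indicator-xor true  false = solve 0 (𝟙 := (𝟙 :+ 𝟘) :+ (:- (𝟙 :+ 𝟙)) :* (𝟙 :* 𝟘)) refl
  indicator-xor false true  = solve 0 (𝟙 := (𝟘 :+ 𝟙) :+ (:- (𝟙 :+ 𝟙)) :* (𝟘 :* 𝟙)) refl
  indicator-xor false false = solve 0 (𝟘 := (𝟘 :+ 𝟘) :+ (:- (𝟙 :+ 𝟙)) :* (𝟘 :* 𝟘)) refl

  sumF-α-indicator : ∀ f → sumF (λ e → α e * indicator (does (f ≟F e))) ≈ α f
  sumF-α-indicator f = trans (sumF-δ (λ e → α e * indicator (does (f ≟F e))) f off)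
                             (trans (*-congˡ (reflexive (≡.cong indicator (does-refl f)))) (*-identityʳ (α f)))
    where
    off : ∀ e → e ≢ f → α e * indicator (does (f ≟F e)) ≈ 0#
    off e e≢f with f ≟F e
    ... | yes f≡e = ⊥-elim (e≢f (≡.sym f≡e))
    ... | no _    = zeroʳ (α e)

  length-path : ∀ {u v} (p : Walk u v) → Unique (vertices p) →
                length commutativeRing α p ≈ sumF (λ e → α e * indicator (parity (edges p) e))
  length-path []           _ = sym (sumF-zero (λ e → α e * 0#) (λ e → zeroʳ (α e)))
  length-path (step f j p) (u∉p AllPairs.∷ uniq) = begin
    α f + length commutativeRing α p
      ≈⟨ +-cong (sym (sumF-α-indicator f)) (length-path p uniq) ⟩
    sumF (λ e → α e * indicator (does (f ≟F e))) + sumF (λ e → α e * indicator (parity (edges p) e))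
      ≈⟨ sumF-distrib-+ (λ e → α e * indicator (does (f ≟F e))) (λ e → α e * indicator (parity (edges p) e)) ⟨
    sumF (λ e → α e * indicator (does (f ≟F e)) + α e * indicator (parity (edges p) e))
      ≈⟨ sumF-cong term ⟩
    sumF (λ e → α e * indicator (does (f ≟F e) xor parity (edges p) e)) ∎
    where
    f∉p : ¬ (f ∈ edges p)
    f∉p f∈p = All.lookup u∉p (endpoint∈vertices p f∈p j) ≡.refl
    term : ∀ e → α e * indicator (does (f ≟F e)) + α e * indicator (parity (edges p) e)
                 ≈ α e * indicator (does (f ≟F e) xor parity (edges p) e)
    term e with f ≟F e
    ... | yes ≡.refl rewrite ∉⇒parity-false (edges p) f f∉p = trans (+-congˡ (zeroʳ (α f))) (+-identityʳ _)
    ... | no _       = trans (+-congʳ (zeroʳ (α e))) (+-identityˡ _)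

  D≈ : ∀ u v → D u v ≈ sumF (λ e → α e * indicator (onRootPath u e xor onRootPath v e))
  D≈ u v = trans (isDist u v p) (trans (length-path (proj₁ p) (proj₂ p))
             (sumF-cong (λ e → *-congˡ (reflexive (≡.cong indicator (proj₂ (path-parity u v) e))))))
    where
    p = proj₁ (path-parity u v)

  D-symmetric : Symmetric D
  D-symmetric u v = trans (D≈ u v) (trans
    (sumF-cong (λ e → *-congˡ (reflexive (≡.cong indicator (xor-comm (onRootPath u e) (onRootPath v e))))))
    (sym (D≈ v u)))

  flow : (Fin n → Carrier) → Fin m → Carrier
  flow x e = sumF (λ v → x v * indicator (onRootPath v e))

  -- With Σ x = 0 the linear terms of [σᵤ xor σᵥ] = σᵤ + σᵥ - 2 σᵤ σᵥ cancel.
  quadForm-D : ∀ x → sumF x ≈ 0# → quadForm D x ≈ (- two) * sumF (λ e → α e * (flow x e * flow x e))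
  quadForm-D x Σx≈0 = begin
    sumF (λ u → sumF (λ v → (x u * D u v) * x v))
      ≈⟨ sumF-cong (λ u → sumF-cong λ v → expand-D u v) ⟩
    sumF (λ u → sumF (λ v → sumF (λ e → α e * ((x u * x v) * t u v e))))
      ≈⟨ trans (sumF-cong (λ u → sumF-comm (λ v e → α e * ((x u * x v) * t u v e))))
               (sumF-comm (λ u e → sumF (λ v → α e * ((x u * x v) * t u v e)))) ⟩
    sumF (λ e → sumF (λ u → sumF (λ v → α e * ((x u * x v) * t u v e))))
      ≈⟨ sumF-cong (λ e → trans (sumF-cong (λ u → sym (*-distribˡ-sumF (α e) (λ v → (x u * x v) * t u v e))))
                                (trans (sym (*-distribˡ-sumF (α e) (λ u → sumF (λ v → (x u * x v) * t u v e))))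
                                       (*-congˡ (per-edge e)))) ⟩
    sumF (λ e → α e * ((- two) * (flow x e * flow x e)))
      ≈⟨ trans (sumF-cong (λ e → solve 3 (λ a w q → a :* (w :* q) := w :* (a :* q)) refl (α e) (- two) (flow x e * flow x e)))
               (sym (*-distribˡ-sumF (- two) (λ e → α e * (flow x e * flow x e)))) ⟩
    (- two) * sumF (λ e → α e * (flow x e * flow x e)) ∎
    where
    s : Fin n → Fin m → Carrier
    s u e = indicator (onRootPath u e)
    t : Fin n → Fin n → Fin m → Carrier
    t u v e = indicator (onRootPath u e xor onRootPath v e)
    expand-D : ∀ u v → (x u * D u v) * x v ≈ sumF (λ e → α e * ((x u * x v) * t u v e))
    expand-D u v = begin
      (x u * D u v) * x v                         ≈⟨ *-congʳ (*-congˡ (D≈ u v)) ⟩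
      (x u * sumF (λ e → α e * t u v e)) * x v    ≈⟨ solve 3 (λ a S b → (a :* S) :* b := (a :* b) :* S) refl (x u) _ (x v) ⟩
      (x u * x v) * sumF (λ e → α e * t u v e)    ≈⟨ *-distribˡ-sumF (x u * x v) (λ e → α e * t u v e) ⟩
      sumF (λ e → (x u * x v) * (α e * t u v e))
        ≈⟨ sumF-cong (λ e → solve 3 (λ p a q → p :* (a :* q) := a :* (p :* q)) refl (x u * x v) (α e) (t u v e)) ⟩
      sumF (λ e → α e * ((x u * x v) * t u v e))  ∎
    per-edge : ∀ e → sumF (λ u → sumF (λ v → (x u * x v) * t u v e)) ≈ (- two) * (flow x e * flow x e)
    per-edge e = begin
      sumF (λ u → sumF (λ v → (x u * x v) * t u v e))
        ≈⟨ sumF-cong (λ u → sumF-cong λ v → trans (*-congˡ (indicator-xor (onRootPath u e) (onRootPath v e)))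
             (solve 4 (λ a b p q → (a :* b) :* ((p :+ q) :+ (:- (con (ℤ.+ 1) :+ con (ℤ.+ 1))) :* (p :* q))
                                   := (a :* p) :* b :+ (a :* (b :* q) :+ (:- (con (ℤ.+ 1) :+ con (ℤ.+ 1))) :* ((a :* p) :* (b :* q))))
                    refl (x u) (x v) (s u e) (s v e))) ⟩
      sumF (λ u → sumF (λ v → xs u * x v + (x u * xs v + (- two) * (xs u * xs v))))
        ≈⟨ trans (sumF-cong (λ u → trans (sumF-distrib-+ (λ v → xs u * x v) _)
                                        (+-congˡ (trans (sumF-distrib-+ (λ v → x u * xs v) _)
                                                        (+-congˡ (sym (*-distribˡ-sumF (- two) (λ v → xs u * xs v))))))))
                 (trans (sumF-distrib-+ (λ u → sumF (λ v → xs u * x v)) _)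
                        (+-congˡ (trans (sumF-distrib-+ (λ u → sumF (λ v → x u * xs v)) _)
                                        (+-congˡ (sym (*-distribˡ-sumF (- two) (λ u → sumF (λ v → xs u * xs v)))))))) ⟩
      sumF (λ u → sumF (λ v → xs u * x v))
        + (sumF (λ u → sumF (λ v → x u * xs v)) + (- two) * sumF (λ u → sumF (λ v → xs u * xs v)))
        ≈⟨ +-cong (sym (sumF-*-sumF xs x)) (+-cong (sym (sumF-*-sumF x xs)) (*-congˡ (sym (sumF-*-sumF xs xs)))) ⟩
      flow x e * sumF x + (sumF x * flow x e + (- two) * (flow x e * flow x e))
        ≈⟨ +-cong (trans (*-congˡ Σx≈0) (zeroʳ _)) (trans (+-congʳ (trans (*-congʳ Σx≈0) (zeroˡ _))) (+-identityˡ _)) ⟩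
      0# + (- two) * (flow x e * flow x e)
        ≈⟨ +-identityˡ _ ⟩
      (- two) * (flow x e * flow x e) ∎
      where
      xs : Fin n → Carrier
      xs u = x u * s u e

  -- Downward induction on depth: x at v is the flow across the parent edge of v minus
  -- the values strictly below v, and x at the root is Σ x minus all other values.
  flow≈0⇒≈0 : ∀ x → sumF x ≈ 0# → (∀ e → flow x e ≈ 0#) → ∀ w → x w ≈ 0#
  flow≈0⇒≈0 x Σx≈0 flow≈0 = WF.All.wfRec (On.wellFounded height <-wellFounded) _ (λ w → x w ≈ 0#) descend
    where
    height : Fin n → ℕ
    height w = suc (sumℕ depth) ℕ.∸ depth w
    deeper : ∀ {v w} → depth v ℕ.< depth w → height w ℕ.< height v
    deeper {w = w} dv<dw = ℕₚ.∸-monoʳ-< dv<dw (ℕₚ.m≤n⇒m≤1+n (≤-sumℕ depth w))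
    descend : ∀ w → (∀ {w′} → height w′ ℕ.< height w → x w′ ≈ 0#) → x w ≈ 0#
    descend w ih with w ≟F ρ
    ... | yes ≡.refl = trans (sym (sumF-δ x ρ below-root)) Σx≈0
      where
      below-root : ∀ w′ → w′ ≢ ρ → x w′ ≈ 0#
      below-root w′ w′≢ρ = ih (deeper (≡.subst (ℕ._< depth w′) (≡.sym depth-root) (depth-nonRoot w′ w′≢ρ)))
    ... | no w≢ρ = begin
      x w                       ≈⟨ *-identityʳ (x w) ⟨
      x w * 1#                  ≈⟨ *-congˡ (reflexive (≡.cong indicator (≡.sym onPath))) ⟩
      x w * indicator (onRootPath w edge) ≈⟨ sumF-δ (λ w′ → x w′ * indicator (onRootPath w′ edge)) w others ⟨
      flow x edge               ≈⟨ flow≈0 edge ⟩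
      0#                        ∎
      where
      open ParentEdge (parentEdge w w≢ρ)
      others : ∀ w′ → w′ ≢ w → x w′ * indicator (onRootPath w′ edge) ≈ 0#
      others w′ w′≢w with onRootPath w′ edge in on
      ... | false = zeroʳ (x w′)
      ... | true with onlyBelow w′ on
      ...   | inj₁ w′≡w = ⊥-elim (w′≢w w′≡w)
      ...   | inj₂ below = trans (*-congʳ (ih (deeper below))) (zeroˡ 1#)

  D-conditionallyNegativeDefinite : ConditionallyNegativeDefinite D
  D-conditionallyNegativeDefinite = record { nonpositive = nonpositive ; definite = definite }
    where
    energy : (Fin n → Carrier) → Carrier
    energy x = sumF (λ e → α e * (flow x e * flow x e))
    energy-terms≥0 : ∀ x e → 0# ≤ (α e * (flow x e * flow x e))
    energy-terms≥0 x e = *-nonneg (proj₁ (α>0 e)) (x*x≥0 (flow x e))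
    quadForm≈-2energy : ∀ x → sumF x ≈ 0# → quadForm D x ≈ - (two * energy x)
    quadForm≈-2energy x Σx≈0 = trans (quadForm-D x Σx≈0) (solve 2 (λ w t → (:- w) :* t := :- (w :* t)) refl two (energy x))
    nonpositive : ∀ x → sumF x ≈ 0# → quadForm D x ≤ 0#
    nonpositive x Σx≈0 = ≲-respˡ-≈ (sym (quadForm≈-2energy x Σx≈0))
                           (-x≤0 (*-nonneg 0≤1+1 (sumF-nonneg _ (energy-terms≥0 x))))
    definite : ∀ x → sumF x ≈ 0# → ∀ i → ¬ (x i ≈ 0#) → ¬ (quadForm D x ≈ 0#)
    definite x Σx≈0 i xᵢ≉0 q≈0 = ¬¬-∀-Fin (λ e → flow x e ≈ 0#) flow≈0 λ flows≈0 →
        xᵢ≉0 (flow≈0⇒≈0 x Σx≈0 flows≈0 i)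
      where
      energy≈0 : energy x ≈ 0#
      energy≈0 = x+x≈0⇒x≈0 (energy x) (begin
        energy x + energy x       ≈⟨ solve 1 (λ t → t :+ t := :- (:- ((con (ℤ.+ 1) :+ con (ℤ.+ 1)) :* t))) refl (energy x) ⟩
        - - (two * energy x)      ≈⟨ -‿cong (trans (sym (quadForm≈-2energy x Σx≈0)) q≈0) ⟩
        - 0#                      ≈⟨ solve 0 (:- con (ℤ.+ 0) := con (ℤ.+ 0)) refl ⟩
        0#                        ∎)
      flow≈0 : ∀ e → ¬ ¬ (flow x e ≈ 0#)
      flow≈0 e with inverse (α e) (λ αₑ≈0 → proj₂ (α>0 e) (sym αₑ≈0))
      ... | α⁻¹ , αα⁻¹≈1 = x*x≈0⇒¬¬x≈0 (flow x e) (begin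
        flow x e * flow x e                ≈⟨ *-identityˡ _ ⟨
        1# * (flow x e * flow x e)         ≈⟨ *-congʳ (trans (sym αα⁻¹≈1) (*-comm _ _)) ⟩
        (α⁻¹ * α e) * (flow x e * flow x e) ≈⟨ *-assoc _ _ _ ⟩
        α⁻¹ * (α e * (flow x e * flow x e)) ≈⟨ *-congˡ (sumF-nonneg-≈0 _ (energy-terms≥0 x) energy≈0 e) ⟩
        α⁻¹ * 0#                           ≈⟨ zeroʳ α⁻¹ ⟩
        0#                                 ∎)

module Reindexing {c ℓ} (R : CommutativeRing c ℓ) {n k : ℕ} (ι : Fin k → Fin n) (ι-injective : Injective _≡_ _≡_ ι) where
  open CommutativeRing R hiding (zero)
  open MatrixDefs R
  open FiniteSums R
  open import Relation.Binary.Reasoning.Setoid setoid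

  SupportedOnImage : (Fin n → Carrier) → Set ℓ
  SupportedOnImage u = ∀ v → (∀ a → ι a ≢ v) → u v ≈ 0#

  private
    hit : Fin k → Fin n → Carrier
    hit a v with ι a ≟F v
    ... | yes _ = 1#
    ... | no  _ = 0#

    hit-ι : ∀ a → hit a (ι a) ≈ 1#
    hit-ι a with ι a ≟F ι a
    ... | yes _   = refl
    ... | no ιa≢ιa = ⊥-elim (ιa≢ιa ≡.refl)

    hit-miss : ∀ a v → ι a ≢ v → hit a v ≈ 0#
    hit-miss a v ιa≢v with ι a ≟F v
    ... | yes ιa≡v = ⊥-elim (ιa≢v ιa≡v)
    ... | no  _    = refl

    hit-once : ∀ (f : Fin n → Carrier) → SupportedOnImage f → ∀ v → f v ≈ sumF (λ a → hit a v * f v)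
    hit-once f supp v with any? (λ a → ι a ≟F v)
    ... | yes (a , ιa≡v) = sym (trans (sumF-δ (λ b → hit b v * f v) a miss)
                                      (trans (*-congʳ (≡.subst (λ w → hit a w ≈ 1#) ιa≡v (hit-ι a))) (*-identityˡ (f v))))
      where
      miss : ∀ b → b ≢ a → hit b v * f v ≈ 0#
      miss b b≢a = trans (*-congʳ (hit-miss b v (λ ιb≡v → b≢a (ι-injective (≡.trans ιb≡v (≡.sym ιa≡v)))))) (zeroˡ (f v))
    ... | no ∄a = trans (supp v (λ a ιa≡v → ∄a (a , ιa≡v)))
                        (sym (sumF-zero (λ a → hit a v * f v)
                                        (λ a → trans (*-congˡ (supp v (λ a ιa≡v → ∄a (a , ιa≡v)))) (zeroʳ _))))

  sumF-supported : ∀ (f : Fin n → Carrier) → SupportedOnImage f → sumF f ≈ sumF (f ∘ ι)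
  sumF-supported f supp = begin
    sumF f                                  ≈⟨ sumF-cong (hit-once f supp) ⟩
    sumF (λ v → sumF (λ a → hit a v * f v)) ≈⟨ sumF-comm (λ v a → hit a v * f v) ⟩
    sumF (λ a → sumF (λ v → hit a v * f v)) ≈⟨ sumF-cong (λ a → sumF-δ (λ v → hit a v * f v) (ι a)
                                                   (λ v v≢ιa → trans (*-congʳ (hit-miss a v (v≢ιa ∘ ≡.sym))) (zeroˡ (f v)))) ⟩
    sumF (λ a → hit a (ι a) * f (ι a))      ≈⟨ sumF-cong (λ a → trans (*-congʳ (hit-ι a)) (*-identityˡ _)) ⟩
    sumF (f ∘ ι)                            ∎

  quadForm-supported : ∀ (D : Fin n → Fin n → Carrier) u → SupportedOnImage u →
                       quadForm D u ≈ quadForm (λ a b → D (ι a) (ι b)) (u ∘ ι)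
  quadForm-supported D u supp = begin
    sumF (λ v → sumF (λ w → (u v * D v w) * u w))
      ≈⟨ sumF-cong (λ v → sumF-supported (λ w → (u v * D v w) * u w) (λ w w∉ → trans (*-congˡ (supp w w∉)) (zeroʳ _))) ⟩
    sumF (λ v → sumF (λ b → (u v * D v (ι b)) * u (ι b)))
      ≈⟨ sumF-supported (λ v → sumF (λ b → (u v * D v (ι b)) * u (ι b)))
                        (λ v v∉ → sumF-zero (λ b → (u v * D v (ι b)) * u (ι b))
                                            (λ b → trans (*-congʳ (trans (*-congʳ (supp v v∉)) (zeroˡ _))) (zeroˡ _))) ⟩
    quadForm (λ a b → D (ι a) (ι b)) (u ∘ ι) ∎

  extend : (Fin k → Carrier) → Fin n → Carrier
  extend x v with any? (λ a → ι a ≟F v)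
  ... | yes (a , _) = x a
  ... | no  _       = 0#

  extend-ι : ∀ x a → extend x (ι a) ≈ x a
  extend-ι x a with any? (λ b → ι b ≟F ι a)
  ... | yes (b , ιb≡ιa) = reflexive (≡.cong x (ι-injective ιb≡ιa))
  ... | no  ∄b          = ⊥-elim (∄b (a , ≡.refl))

  extend-supported : ∀ x → SupportedOnImage (extend x)
  extend-supported x v v∉ with any? (λ b → ι b ≟F v)
  ... | yes (b , ιb≡v) = ⊥-elim (v∉ b ιb≡v)
  ... | no  _          = refl

  sumF-extend : ∀ x → sumF (extend x) ≈ sumF x
  sumF-extend x = trans (sumF-supported (extend x) (extend-supported x)) (sumF-cong (extend-ι x))

  quadForm-extend : ∀ (D : Fin n → Fin n → Carrier) x → quadForm D (extend x) ≈ quadForm (λ a b → D (ι a) (ι b)) x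
  quadForm-extend D x = trans (quadForm-supported D (extend x) (extend-supported x))
    (sumF-cong λ a → sumF-cong λ b → *-cong (*-congʳ (extend-ι x a)) (extend-ι x b))

module Restriction {c ℓ₁ ℓ₂} (F : OrderedField c ℓ₁ ℓ₂) {n k : ℕ} (ι : Fin k → Fin n)
  (ι-injective : Injective _≡_ _≡_ ι) where
  open OrderedField F hiding (zero)
  open OrderedFieldProperties F using (≲-respˡ-≈)
  open ConditionallyNegativeDefiniteMatrices F
  open Reindexing commutativeRing ι ι-injective

  restrict-conditionallyNegativeDefinite : ∀ {D : Fin n → Fin n → Carrier} → ConditionallyNegativeDefinite D →
    ConditionallyNegativeDefinite (λ a b → D (ι a) (ι b))
  restrict-conditionallyNegativeDefinite {D} cnd = record
    { nonpositive = λ x Σx≈0 → ≲-respˡ-≈ (quadForm-extend D x) (nonpositive (extend x) (trans (sumF-extend x) Σx≈0))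
    ; definite    = λ x Σx≈0 i xᵢ≉0 q≈0 → definite (extend x) (trans (sumF-extend x) Σx≈0) (ι i)
                      (λ x′≈0 → xᵢ≉0 (trans (sym (extend-ι x i)) x′≈0)) (trans (quadForm-extend D x) q≈0)
    }
    where
    open ConditionallyNegativeDefinite cnd

corollary4p3 : ∀ {c ℓ₁ ℓ₂ : Level} (F : OrderedField c ℓ₁ ℓ₂)
    → let open OrderedField F
          open MatrixDefs commutativeRing
      in ∀ (n m : ℕ) (G : Graph n m) (α : Fin m → Carrier) (D : Fin n → Fin n → Carrier)
         → GraphDefs.IsTree G
         → (∀ e → 0# < α e)
         → GraphDefs.IsDistanceMatrix G commutativeRing α D
         → ∀ (k : ℕ) (ι : Fin (suc k) → Fin n) → Injective _≡_ _≡_ ι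
         → let DS = λ a b → D (ι a) (ι b)
               Feasible = λ (u : Fin n → Carrier)
                 → (sumF u ≈ 1#) × (∀ v → (∀ a → ι a ≢ v) → u v ≈ 0#)
           in ¬ (cof k DS ≈ 0#)
              × Σ Carrier (λ r → ((r * cof k DS) ≈ det (suc k) DS)
                  × Σ (Fin n → Carrier) (λ u → Feasible u × (quadForm D u ≈ r))
                  × (∀ u → Feasible u → quadForm D u ≤ r))
corollary4p3 F n m G α D tree α>0 isDist k ι ι-injective =
  cof≉0 , r , sym det≈r*cof ,
  (extend u , (trans (sumF-extend u) sumF-u , extend-supported u) , trans (quadForm-extend D u) quadForm-u) ,
  λ v (sumF-v≈1 , supp) → ≲-respˡ-≈ (sym (quadForm-supported D v supp))
                              (quadForm≤r (v ∘ ι) (trans (sym (sumF-supported v supp)) sumF-v≈1))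
  where
  open OrderedField F hiding (zero)
  open OrderedFieldProperties F using (≲-respˡ-≈)
  open ConditionallyNegativeDefiniteMatrices F using (module Maximiser)
  open Reindexing commutativeRing ι ι-injective
  open Restriction F ι ι-injective
  open TreeDistanceMatrix F G tree α α>0 D isDist (ι zero)
  open Maximiser (λ a b → D (ι a) (ι b)) (λ a b → D-symmetric (ι a) (ι b))
                 (restrict-conditionallyNegativeDefinite D-conditionallyNegativeDefinite)
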